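{- Let $k\ge5$ be an odd integer and let $t,s$ be integers with $1\le t\le\frac{k-1}{2}$ and $t+s\ge k$. Let $B$ be a graph consisting of a vertex $v$, a path from $v$ to $x$ with $t-1$ internal vertices, a path from $v$ to $y$ with $t-1$ internal vertices, and a necklace $N(v,z)$ with end vertices $v,z$ in which the distance from $v$ to $z$ is $s$, where these three pieces share the vertex $v$ and are otherwise internally vertex-disjoint. Let $\varphi$ assign to each of $x,y,z$ a $\frac{k-1}{2}$-element subset of $\{1,\dots,k\}$ such that $|\varphi(x)\cap\varphi(y)|=\frac{k-1-2t}{2}$. Then $\varphi$ extends to a fractional $(k:\frac{k-1}{2})$-coloring of $B$.
   Context: A fractional $(k:\frac{k-1}{2})$-coloring of a graph assigns to each vertex $v$ a $\frac{k-1}{2}$-element subset $\varphi(v)\subseteq\{1,\dots,k\}$ with $\varphi(u)\cap\varphi(v)=\emptyset$ for every edge $uv$. A necklace $N(a,b)$ with end vertices $a,b$ is a graph obtained from a path $a=z_0z_1\cdots z_m=b$ by replacing some of its edges $z_iz_{i+1}$ by a $k$-cycle passing through $z_i$ and $z_{i+1}$ whose remaining vertices are new (distinct replaced edges receive disjoint sets of new vertices). The graph $B$ is what the paper calls the bull-necklace $B_v(t,s)$ with end vertices $x,y,z$. -}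

module Defs where

open import Data.Nat using (ℕ; zero; suc; _<_; _≤_; _<ᵇ_; _≡ᵇ_)
open import Data.Bool using (Bool; true; false; T; not; _∧_; if_then_else_)
open import Data.Bool.Properties using (T?)
open import Data.Fin using (Fin; fromℕ; inject₁) renaming (zero to fzero; suc to fsuc)
open import Data.Fin.Subset using (Subset; ∣_∣; _∩_; Empty)
open import Data.List using (List; []; _∷_)
open import Data.Product using (_×_)
open import Relation.Nullary using (yes; no)
open import Relation.Binary.PropositionalEquality using (_≡_)

-- Generic graph notions (a graph = vertex type V with an edge relation E;
-- edges are undirected: E u w is read as the edge uw).

data Walk {V : Set} (E : V → V → Set) : V → V → ℕ → Set where
  here  : ∀ {u} → Walk E u u 0
  stepF : ∀ {u w x n} → E u w → Walk E w x n → Walk E u x (suc n)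
  stepB : ∀ {u w x n} → E w u → Walk E w x n → Walk E u x (suc n)

Dist : {V : Set} (E : V → V → Set) → V → V → ℕ → Set
Dist E u w s = Walk E u w s × (∀ n → Walk E u w n → s ≤ n)

Disjoint : ∀ {n} → Subset n → Subset n → Set
Disjoint p q = Empty (p ∩ q)

IsFracColoring : (k h : ℕ) {V : Set} (E : V → V → Set) → (V → Subset k) → Set
IsFracColoring k h {V} E φ =
  (∀ u → ∣ φ u ∣ ≡ h) × (∀ {u w} → E u w → Disjoint (φ u) (φ w))

module _ (k : ℕ) where

  -- A bead replaces (or keeps) an edge z_i z_{i+1} of the base path.
  --   edge      : the edge z_i z_{i+1} is kept.
  --   cyc d _   : the edge is replaced by a k-cycle c_0 c_1 ... c_{k-1} c_0
  --               with c_0 = z_i, c_d = z_{i+1} (1 ≤ d ≤ k-1) and all other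
  --               c_j new vertices.
  data Bead : Set where
    edge : Bead
    cyc  : (d : ℕ) → T ((0 <ᵇ d) ∧ (d <ᵇ k)) → Bead

  isInner : ℕ → ℕ → Bool
  isInner d j = (0 <ᵇ j) ∧ ((j <ᵇ k) ∧ not (j ≡ᵇ d))

  -- Vertices of the necklace built from a list of beads z_0 … z_m.
  data NV : List Bead → Set where
    start  : ∀ {bs} → NV bs
    rest   : ∀ {b bs} → NV bs → NV (b ∷ bs)                   -- vertices of the tail necklace (from z_1 on)
    innerV : ∀ {d p bs} (j : ℕ) → T (isInner d j) → NV (cyc d p ∷ bs)

  end : (bs : List Bead) → NV bs
  end []       = start
  end (b ∷ bs) = rest (end bs)

  -- vertex at position j of the first bead's cycle (j = 0 or j = k gives z_0)
  cpos : ∀ {d p bs} → ℕ → NV (cyc d p ∷ bs)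
  cpos {d} j with T? (isInner d j)
  ... | yes q = innerV j q
  ... | no _  = if j ≡ᵇ d then rest start else start

  data NE : (bs : List Bead) → NV bs → NV bs → Set where
    plainE : ∀ {bs} → NE (edge ∷ bs) start (rest start)
    cycE   : ∀ {d p bs} (j : ℕ) → j < k → NE (cyc d p ∷ bs) (cpos j) (cpos (suc j))
    restE  : ∀ {b bs u w} → NE bs u w → NE (b ∷ bs) (rest u) (rest w)

  -- The bull-necklace B_v(t,s): hub v, two paths v…x and v…y each with
  -- tp = t-1 internal vertices, and the necklace N(v,z) given by bs,
  -- sharing only v.

  data BV (tp : ℕ) (bs : List Bead) : Set where
    xp : Fin (suc tp) → BV tp bs   -- xp i : vertex at distance i+1 from v on the v–x path
    yp : Fin (suc tp) → BV tp bs   -- yp i : vertex at distance i+1 from v on the v–y path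
    nk : NV bs → BV tp bs

  hub : ∀ {tp bs} → BV tp bs
  hub = nk start

  endX endY : ∀ {tp bs} → BV tp bs
  endX {tp} = xp (fromℕ tp)
  endY {tp} = yp (fromℕ tp)

  endZ : ∀ {tp} (bs : List Bead) → BV tp bs
  endZ bs = nk (end bs)

  data BE (tp : ℕ) (bs : List Bead) : BV tp bs → BV tp bs → Set where
    xv  : BE tp bs hub (xp fzero)
    xx  : (i : Fin tp) → BE tp bs (xp (inject₁ i)) (xp (fsuc i))
    yv  : BE tp bs hub (yp fzero)
    yy  : (i : Fin tp) → BE tp bs (yp (inject₁ i)) (yp (fsuc i))
    nkE : ∀ {u w} → NE bs u w → BE tp bs (nk u) (nk w)

module Submission where

-- In K(2h+1, h) (the h-subsets of {1..k}, adjacent when disjoint) two vertices meeting in c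
-- elements are joined by walks of lengths 2(h − c) and 2c + 1, exchanging elements one at a
-- time.  So a k-cycle bead whose arcs between z_i and z_{i+1} have lengths d and k − d can be
-- coloured exactly when the colours of z_i and z_{i+1} meet in the number of elements that d
-- dictates, and colouring the necklace bead by bead (counting in the Venn regions of the
-- current colour and φ(z)) succeeds whenever the overlap of its end colours lies in a window
-- given by the shortest even and odd walks from v to z.  The hub v gets a colour C with walks
-- of length t to φ(x) and φ(y): C contains φ(x) ∩ φ(y) or the complement of φ(x) ∪ φ(y),
-- and equally many elements of φ(x) − φ(y) and φ(y) − φ(x), chosen so that ∣C ∩ φ(z)∣
-- falls into the window; t + s ≥ k is what makes the window wide enough.

open import Defs
open import Data.Nat
open import Data.Nat.Properties
open import Data.Bool using (true; false; T; not; _∧_)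
open import Data.Bool.Properties using (T?; T-≡; ¬-not; not-involutive)
open import Data.List using (List; []; _∷_)
open import Relation.Nullary using (yes; no; ¬_)
open import Data.Vec using ([]; _∷_; here)
open import Data.Fin using (Fin; toℕ; fromℕ; inject₁) renaming (zero to fzero)
open import Data.Fin.Properties using (toℕ-inject₁; toℕ-fromℕ; toℕ≤pred[n]; toℕ<n)
open import Data.Fin.Subset
open import Data.Fin.Subset.Properties
open import Data.Product using (Σ; _×_; _,_; proj₁; proj₂)
open import Data.Sum using (_⊎_; inj₁; inj₂; [_,_])
open import Data.Empty using (⊥-elim)
open import Function using (_∘_; _$_)
open import Function.Bundles using (Equivalence)
open import Relation.Binary.PropositionalEquality hiding ([_])
open import Relation.Nullary.Negation using (contradiction)
open import Data.Nat.Tactic.RingSolver using (solve-∀)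

m+m≤n+n⇒m≤n : ∀ {m n} → m + m ≤ n + n → m ≤ n
m+m≤n+n⇒m≤n le = ≮⇒≥ λ n<m → <⇒≱ (+-mono-< n<m n<m) le

1+m+m≤n+n⇒m<n : ∀ {m n} → suc (m + m) ≤ n + n → m < n
1+m+m≤n+n⇒m<n le = ≮⇒≥ λ n<1+m → <⇒≱ le (+-mono-≤ (≤-pred n<1+m) (≤-pred n<1+m))

m+m≤1+n+n⇒m≤n : ∀ {m n} → m + m ≤ suc (n + n) → m ≤ n
m+m≤1+n+n⇒m≤n le = ≮⇒≥ λ n<m → <⇒≱ (+-mono-≤-< n<m n<m) le

x+d≡k⇒k∸d≡x : ∀ {x d k} → x + d ≡ k → k ∸ d ≡ x
x+d≡k⇒k∸d≡x {x} {d} e = trans (cong (_∸ d) (sym e)) (m+n∸n≡m x d)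

∸-suc : ∀ {m n} → n < m → m ∸ n ≡ suc (m ∸ suc n)
∸-suc {suc m} {zero}  _         = refl
∸-suc {suc m} {suc n} (s≤s n<m) = ∸-suc n<m

∸≤-swap : ∀ {m n o} → m ∸ n ≤ o → m ∸ o ≤ n
∸≤-swap {m} {n} {o} m∸n≤o =
  m≤n+o⇒m∸n≤o m o (≤-trans (m≤n+m∸n m n) (subst (n + (m ∸ n) ≤_) (+-comm n o) (+-monoʳ-≤ n m∸n≤o)))

m⊓n+[m∸n]⊓o≡m : ∀ {m n o} → m ≤ n + o → m ⊓ n + (m ∸ n) ⊓ o ≡ m
m⊓n+[m∸n]⊓o≡m {m} {n} {o} m≤n+o with m ≤? n
... | yes m≤n = trans (cong₂ _+_ (m≤n⇒m⊓n≡m m≤n) (cong (_⊓ o) (m≤n⇒m∸n≡0 m≤n))) (+-identityʳ m)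
... | no  m≰n = trans (cong₂ _+_ (m≥n⇒m⊓n≡n n≤m) (m≤n⇒m⊓n≡m (m≤n+o⇒m∸n≤o m n m≤n+o))) (m+[n∸m]≡n n≤m)
  where
  n≤m : n ≤ m
  n≤m = <⇒≤ (≰⇒> m≰n)

m∸[m⊓n]≡m∸n : ∀ m n → m ∸ m ⊓ n ≡ m ∸ n
m∸[m⊓n]≡m∸n m n = trans (∸-distribˡ-⊓-⊔ m m n) (cong (_⊔ (m ∸ n)) (n∸n≡0 m))

≤⊓+⊓ : ∀ {x a b c d} → x ≤ a + c → x ≤ a + d → x ≤ b + c → x ≤ b + d → x ≤ a ⊓ b + c ⊓ d
≤⊓+⊓ {x} {a} {b} {c} {d} ac ad bc bd =
  subst (x ≤_) (sym (trans (+-distribʳ-⊓ (c ⊓ d) a b) (cong₂ _⊓_ (+-distribˡ-⊓ a c d) (+-distribˡ-⊓ b c d))))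
        (⊓-glb (⊓-glb ac ad) (⊓-glb bc bd))

⊓-pick : ∀ {P : ℕ → Set} x y → P x → P y → P (x ⊓ y)
⊓-pick {P} x y px py with ⊓-sel x y
... | inj₁ x⊓y≡x = subst P (sym x⊓y≡x) px
... | inj₂ x⊓y≡y = subst P (sym x⊓y≡y) py

interval-sum : ∀ {l₁ u₁ l₂ u₂ x} → l₁ ≤ u₁ → l₂ ≤ u₂ → l₁ + l₂ ≤ x → x ≤ u₁ + u₂ →
               Σ ℕ λ y → Σ ℕ λ z → (l₁ ≤ y × y ≤ u₁) × (l₂ ≤ z × z ≤ u₂) × y + z ≡ x
interval-sum {l₁} {u₁} {l₂} {u₂} {x} l₁≤u₁ l₂≤u₂ l₁+l₂≤x x≤u₁+u₂ with x ≤? u₁ + l₂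
... | yes x≤u₁+l₂ = x ∸ l₂ , l₂ , (m+n≤o⇒m≤o∸n l₁ l₁+l₂≤x , m≤n+o⇒m∸n≤o x l₂ (subst (x ≤_) (+-comm u₁ l₂) x≤u₁+l₂)) ,
                    (≤-refl , l₂≤u₂) , m∸n+n≡m (≤-trans (m≤n+m l₂ l₁) l₁+l₂≤x)
... | no  x≰u₁+l₂ = u₁ , x ∸ u₁ , (l₁≤u₁ , ≤-refl) ,
                    (m+n≤o⇒m≤o∸n l₂ (subst (_≤ x) (+-comm u₁ l₂) u₁+l₂≤x) , m≤n+o⇒m∸n≤o x u₁ x≤u₁+u₂) ,
                    m+[n∸m]≡n (≤-trans (m≤m+n u₁ l₂) u₁+l₂≤x)
  where
  u₁+l₂≤x : u₁ + l₂ ≤ x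
  u₁+l₂≤x = <⇒≤ (≰⇒> x≰u₁+l₂)

data EvenOdd : ℕ → Set where
  even : ∀ m → EvenOdd (m + m)
  odd  : ∀ m → EvenOdd (suc (m + m))

evenOdd : ∀ d → EvenOdd d
evenOdd zero = even 0
evenOdd (suc d) with evenOdd d
... | even m = odd m
... | odd  m = subst EvenOdd (cong suc (+-suc m m)) (even (suc m))

≢⇒≡ᵇ≡false : ∀ {m n} → m ≢ n → (m ≡ᵇ n) ≡ false
≢⇒≡ᵇ≡false {m} {n} m≢n = ¬-not (λ e → m≢n (≡ᵇ⇒≡ m n (Equivalence.from T-≡ e)))

≡ᵇ-refl : ∀ m → (m ≡ᵇ m) ≡ true
≡ᵇ-refl m = Equivalence.to T-≡ (≡⇒≡ᵇ m m refl)

private variable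
  n : ℕ
  p q s p′ q′ : Subset n

Disjoint-sym : Disjoint p q → Disjoint q p
Disjoint-sym {p = p} {q} d = d ∘ subst Nonempty (∩-comm q p)

Disjoint-⊆ : p′ ⊆ p → q′ ⊆ q → Disjoint p q → Disjoint p′ q′
Disjoint-⊆ {p′ = p′} {q′ = q′} sp sq d (x , x∈) with x∈p∩q⁻ p′ q′ x∈
... | x∈p′ , x∈q′ = d (x , x∈p∩q⁺ (sp x∈p′ , sq x∈q′))

Disjoint-∪ʳ : Disjoint p q → Disjoint p s → Disjoint p (q ∪ s)
Disjoint-∪ʳ {p = p} {q} {s} d e (x , x∈) with x∈p∩q⁻ p (q ∪ s) x∈
... | x∈p , x∈q∪s with x∈p∪q⁻ q s x∈q∪s
...   | inj₁ x∈q = d (x , x∈p∩q⁺ (x∈p , x∈q))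
...   | inj₂ x∈s = e (x , x∈p∩q⁺ (x∈p , x∈s))

Disjoint-∪ˡ : Disjoint p s → Disjoint q s → Disjoint (p ∪ q) s
Disjoint-∪ˡ d e = Disjoint-sym (Disjoint-∪ʳ (Disjoint-sym d) (Disjoint-sym e))

Disjoint-∁ : Disjoint p (∁ p)
Disjoint-∁ {p = p} (x , x∈) with x∈p∩q⁻ p (∁ p) x∈
... | x∈p , x∈∁p = x∈p⇒x∉∁p x∈p x∈∁p

Disjoint-∪³ : ∀ {x₁ x₂ x₃ y₁ y₂ y₃ : Subset n} →
  Disjoint x₁ y₁ → Disjoint x₁ y₂ → Disjoint x₁ y₃ →
  Disjoint x₂ y₁ → Disjoint x₂ y₂ → Disjoint x₂ y₃ →
  Disjoint x₃ y₁ → Disjoint x₃ y₂ → Disjoint x₃ y₃ →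
  Disjoint (x₁ ∪ (x₂ ∪ x₃)) (y₁ ∪ (y₂ ∪ y₃))
Disjoint-∪³ d₁₁ d₁₂ d₁₃ d₂₁ d₂₂ d₂₃ d₃₁ d₃₂ d₃₃ =
  Disjoint-∪ˡ (row d₁₁ d₁₂ d₁₃) (Disjoint-∪ˡ (row d₂₁ d₂₂ d₂₃) (row d₃₁ d₃₂ d₃₃))
  where
  row : ∀ {x y₁ y₂ y₃ : Subset n} → Disjoint x y₁ → Disjoint x y₂ → Disjoint x y₃ →
        Disjoint x (y₁ ∪ (y₂ ∪ y₃))
  row d e f = Disjoint-∪ʳ d (Disjoint-∪ʳ e f)

∪-⊆ : p ⊆ s → q ⊆ s → p ∪ q ⊆ s
∪-⊆ {p = p} {q = q} sp sq x∈ = [ sp , sq ] (x∈p∪q⁻ p q x∈)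

⊆⇒∩≡ : p ⊆ q → p ∩ q ≡ p
⊆⇒∩≡ {p = p} {q} sp = ⊆-antisym (p∩q⊆p p q) (λ x∈ → x∈p∩q⁺ (x∈ , sp x∈))

p∩q∪p∩∁q≡p : ∀ (p q : Subset n) → (p ∩ q) ∪ (p ∩ ∁ q) ≡ p
p∩q∪p∩∁q≡p p q = begin
  (p ∩ q) ∪ (p ∩ ∁ q) ≡⟨ ∩-distribˡ-∪ p q (∁ q) ⟨
  p ∩ (q ∪ ∁ q)       ≡⟨ cong (p ∩_) (∪-inverseʳ q) ⟩
  p ∩ ⊤               ≡⟨ ∩-identityʳ p ⟩
  p                   ∎
  where open ≡-Reasoning

∁∁p≡p : ∀ (p : Subset n) → ∁ (∁ p) ≡ p
∁∁p≡p []      = refl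
∁∁p≡p (x ∷ p) = cong₂ _∷_ (not-involutive x) (∁∁p≡p p)

p∩∁⊥≡p : ∀ (p : Subset n) → p ∩ ∁ ⊥ ≡ p
p∩∁⊥≡p p = ⊆⇒∩≡ (λ _ → x∉p⇒x∈∁p ∉⊥)

∣p∪q∣≡∣p∣+∣q∣ : Disjoint p q → ∣ p ∪ q ∣ ≡ ∣ p ∣ + ∣ q ∣
∣p∪q∣≡∣p∣+∣q∣ {p = []}        {[]}        _ = refl
∣p∪q∣≡∣p∣+∣q∣ {p = true ∷ p}  {true ∷ q}  d = ⊥-elim (d (fzero , here))
∣p∪q∣≡∣p∣+∣q∣ {p = true ∷ p}  {false ∷ q} d = cong suc (∣p∪q∣≡∣p∣+∣q∣ (drop-∷-Empty d))
∣p∪q∣≡∣p∣+∣q∣ {p = false ∷ p} {true ∷ q}  d =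
  trans (cong suc (∣p∪q∣≡∣p∣+∣q∣ (drop-∷-Empty d))) (sym (+-suc ∣ p ∣ ∣ q ∣))
∣p∪q∣≡∣p∣+∣q∣ {p = false ∷ p} {false ∷ q} d = ∣p∪q∣≡∣p∣+∣q∣ (drop-∷-Empty d)

∣p∪q∩s∣≡∣p∩s∣+∣q∩s∣ : Disjoint p q → ∣ (p ∪ q) ∩ s ∣ ≡ ∣ p ∩ s ∣ + ∣ q ∩ s ∣
∣p∪q∩s∣≡∣p∩s∣+∣q∩s∣ {p = p} {q} {s} d =
  trans (cong ∣_∣ (∩-distribʳ-∪ s p q))
        (∣p∪q∣≡∣p∣+∣q∣ (Disjoint-⊆ (p∩q⊆p p s) (p∩q⊆p q s) d))

Disjoint⇒∣p∩q∣≡0 : {p q : Subset n} → Disjoint p q → ∣ p ∩ q ∣ ≡ 0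
Disjoint⇒∣p∩q∣≡0 {n = n} d = trans (cong ∣_∣ (Empty-unique d)) (∣⊥∣≡0 n)

∣p∣≡0⇒p≡⊥ : ∣ p ∣ ≡ 0 → p ≡ ⊥
∣p∣≡0⇒p≡⊥ {p = []}        _ = refl
∣p∣≡0⇒p≡⊥ {p = false ∷ p} e = cong (false ∷_) (∣p∣≡0⇒p≡⊥ e)

∣p∩q∣≡0⇒Disjoint : ∣ p ∩ q ∣ ≡ 0 → Disjoint p q
∣p∩q∣≡0⇒Disjoint e (x , x∈) = ∉⊥ (subst (x ∈_) (∣p∣≡0⇒p≡⊥ e) x∈)

∣p∩q∣+∣p∩∁q∣≡∣p∣ : ∀ (p q : Subset n) → ∣ p ∩ q ∣ + ∣ p ∩ ∁ q ∣ ≡ ∣ p ∣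
∣p∩q∣+∣p∩∁q∣≡∣p∣ p q = trans (sym (∣p∪q∣≡∣p∣+∣q∣ (Disjoint-⊆ (p∩q⊆q p q) (p∩q⊆q p (∁ q)) Disjoint-∁)))
                               (cong ∣_∣ (p∩q∪p∩∁q≡p p q))

∣p∣+∣∁p∣≡n : ∀ (p : Subset n) → ∣ p ∣ + ∣ ∁ p ∣ ≡ n
∣p∣+∣∁p∣≡n {n} p = trans (cong (∣ p ∣ +_) (∣∁p∣≡n∸∣p∣ p)) (m+[n∸m]≡n (∣p∣≤n p))

∣p∩q∣≡∣p∣⇒p⊆q : ∣ p ∩ q ∣ ≡ ∣ p ∣ → p ⊆ q
∣p∩q∣≡∣p∣⇒p⊆q {p = p} {q} e x∈p = x∉∁p⇒x∈p λ x∈∁q →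
  ∉⊥ (subst (_ ∈_) (∣p∣≡0⇒p≡⊥ rest≡0) (x∈p∩q⁺ (x∈p , x∈∁q)))
  where
  rest≡0 : ∣ p ∩ ∁ q ∣ ≡ 0
  rest≡0 = +-cancelˡ-≡ ∣ p ∩ q ∣ _ _ (trans (∣p∩q∣+∣p∩∁q∣≡∣p∣ p q) (trans (sym e) (sym (+-identityʳ _))))

lowest : ℕ → Subset n → Subset n
lowest zero    p           = ⊥
lowest (suc r) []          = []
lowest (suc r) (true ∷ p)  = true ∷ lowest r p
lowest (suc r) (false ∷ p) = false ∷ lowest (suc r) p

lowest-⊆ : ∀ r (p : Subset n) → lowest r p ⊆ p
lowest-⊆ zero    p           = ⊥⊆
lowest-⊆ (suc r) []          = ⊆-refl
lowest-⊆ (suc r) (true ∷ p)  = s⊆s (lowest-⊆ r p)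
lowest-⊆ (suc r) (false ∷ p) = s⊆s (lowest-⊆ (suc r) p)

lowest-mono : ∀ {r r′} (p : Subset n) → r ≤ r′ → lowest r p ⊆ lowest r′ p
lowest-mono {r = zero}              p           _         = ⊥⊆
lowest-mono {r = suc r} {suc r′} []          _         = ⊆-refl
lowest-mono {r = suc r} {suc r′} (true ∷ p)  (s≤s r≤r′) = s⊆s (lowest-mono p r≤r′)
lowest-mono {r = suc r} {suc r′} (false ∷ p) r≤r′      = s⊆s (lowest-mono p r≤r′)

∣lowest∣ : ∀ r (p : Subset n) → ∣ lowest r p ∣ ≡ r ⊓ ∣ p ∣
∣lowest∣ {n} zero p           = ∣⊥∣≡0 n
∣lowest∣ (suc r) []          = refl
∣lowest∣ (suc r) (true ∷ p)  = cong suc (∣lowest∣ r p)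
∣lowest∣ (suc r) (false ∷ p) = ∣lowest∣ (suc r) p

∣lowest∣≡ : ∀ r (p : Subset n) → r ≤ ∣ p ∣ → ∣ lowest r p ∣ ≡ r
∣lowest∣≡ r p r≤∣p∣ = trans (∣lowest∣ r p) (m≤n⇒m⊓n≡m r≤∣p∣)

lowest-all : ∀ r (p : Subset n) → ∣ p ∣ ≤ r → lowest r p ≡ p
lowest-all r p ∣p∣≤r = ⊆-antisym (lowest-⊆ r p) (∣p∩q∣≡∣p∣⇒p⊆q (begin
  ∣ p ∩ lowest r p ∣ ≡⟨ cong ∣_∣ (trans (∩-comm p _) (⊆⇒∩≡ (lowest-⊆ r p))) ⟩
  ∣ lowest r p ∣     ≡⟨ ∣lowest∣ r p ⟩
  r ⊓ ∣ p ∣         ≡⟨ m≥n⇒m⊓n≡n ∣p∣≤r ⟩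
  ∣ p ∣             ∎))
  where open ≡-Reasoning

∣p∩∁lowest∣ : ∀ r (p : Subset n) → r ≤ ∣ p ∣ → ∣ p ∩ ∁ (lowest r p) ∣ ≡ ∣ p ∣ ∸ r
∣p∩∁lowest∣ r p r≤∣p∣ = begin
  ∣ p ∩ ∁ (lowest r p) ∣                         ≡⟨ m+n∸m≡n r _ ⟨
  r + ∣ p ∩ ∁ (lowest r p) ∣ ∸ r                 ≡⟨ cong (λ x → x + ∣ p ∩ ∁ (lowest r p) ∣ ∸ r) ∣p∩lowest∣ ⟨
  ∣ p ∩ lowest r p ∣ + ∣ p ∩ ∁ (lowest r p) ∣ ∸ r ≡⟨ cong (_∸ r) (∣p∩q∣+∣p∩∁q∣≡∣p∣ p (lowest r p)) ⟩
  ∣ p ∣ ∸ r                                     ∎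
  where
  open ≡-Reasoning
  ∣p∩lowest∣ : ∣ p ∩ lowest r p ∣ ≡ r
  ∣p∩lowest∣ = trans (cong ∣_∣ (trans (∩-comm p _) (⊆⇒∩≡ (lowest-⊆ r p)))) (∣lowest∣≡ r p r≤∣p∣)

lowest#rest : ∀ r r′ (p : Subset n) → r ≤ r′ → Disjoint (lowest r p) (p ∩ ∁ (lowest r′ p))
lowest#rest r r′ p r≤r′ = Disjoint-⊆ (lowest-mono p r≤r′) (p∩q⊆q _ _) Disjoint-∁

∣lowest∩∣≡ : ∀ c {p w : Subset n} → p ⊆ w → c ≤ ∣ p ∣ → ∣ lowest c p ∩ w ∣ ≡ c
∣lowest∩∣≡ c {p} p⊆w c≤∣p∣ = trans (cong ∣_∣ (⊆⇒∩≡ (⊆-trans (lowest-⊆ c p) p⊆w))) (∣lowest∣≡ c p c≤∣p∣)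

∣lowest∩∣≡0 : ∀ c {p w : Subset n} → Disjoint p w → ∣ lowest c p ∩ w ∣ ≡ 0
∣lowest∩∣≡0 c {p} p#w = Disjoint⇒∣p∩q∣≡0 (Disjoint-⊆ (lowest-⊆ c p) ⊆-refl p#w)

pick : ℕ → Subset n → Subset n → Subset n
pick r p s = lowest r (p ∩ s) ∪ lowest (r ∸ ∣ p ∩ s ∣) (p ∩ ∁ s)

module _ (r : ℕ) (p s : Subset n) where

  private
    halves# : Disjoint (lowest r (p ∩ s)) (lowest (r ∸ ∣ p ∩ s ∣) (p ∩ ∁ s))
    halves# = Disjoint-⊆ (⊆-trans (lowest-⊆ r (p ∩ s)) (p∩q⊆q p s))
                         (⊆-trans (lowest-⊆ (r ∸ ∣ p ∩ s ∣) (p ∩ ∁ s)) (p∩q⊆q p (∁ s))) Disjoint-∁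

  pick-⊆ : pick r p s ⊆ p
  pick-⊆ = ∪-⊆ (⊆-trans (lowest-⊆ r (p ∩ s)) (p∩q⊆p p s))
               (⊆-trans (lowest-⊆ (r ∸ ∣ p ∩ s ∣) (p ∩ ∁ s)) (p∩q⊆p p (∁ s)))

  ∣pick∣ : r ≤ ∣ p ∣ → ∣ pick r p s ∣ ≡ r
  ∣pick∣ r≤∣p∣ = trans (∣p∪q∣≡∣p∣+∣q∣ halves#)
    (trans (cong₂ _+_ (∣lowest∣ r (p ∩ s)) (∣lowest∣ (r ∸ ∣ p ∩ s ∣) (p ∩ ∁ s)))
           (m⊓n+[m∸n]⊓o≡m (subst (r ≤_) (sym (∣p∩q∣+∣p∩∁q∣≡∣p∣ p s)) r≤∣p∣)))

  ∣pick∩s∣ : ∣ pick r p s ∩ s ∣ ≡ r ⊓ ∣ p ∩ s ∣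
  ∣pick∩s∣ = begin
    ∣ pick r p s ∩ s ∣
      ≡⟨ ∣p∪q∩s∣≡∣p∩s∣+∣q∩s∣ halves# ⟩
    ∣ lowest r (p ∩ s) ∩ s ∣ + ∣ lowest (r ∸ ∣ p ∩ s ∣) (p ∩ ∁ s) ∩ s ∣
      ≡⟨ cong₂ _+_ (cong ∣_∣ (⊆⇒∩≡ (⊆-trans (lowest-⊆ r (p ∩ s)) (p∩q⊆q p s))))
                   (∣lowest∩∣≡0 (r ∸ ∣ p ∩ s ∣) (Disjoint-⊆ (p∩q⊆q p (∁ s)) ⊆-refl (Disjoint-sym Disjoint-∁))) ⟩
    ∣ lowest r (p ∩ s) ∣ + 0
      ≡⟨ trans (+-identityʳ _) (∣lowest∣ r (p ∩ s)) ⟩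
    r ⊓ ∣ p ∩ s ∣ ∎
    where open ≡-Reasoning

  ∣pick∩∁s∣ : r ≤ ∣ p ∣ → ∣ pick r p s ∩ ∁ s ∣ ≡ r ∸ ∣ p ∩ s ∣
  ∣pick∩∁s∣ r≤∣p∣ = begin
    ∣ pick r p s ∩ ∁ s ∣                                  ≡⟨ m+n∸m≡n ∣ pick r p s ∩ s ∣ _ ⟨
    ∣ pick r p s ∩ s ∣ + ∣ pick r p s ∩ ∁ s ∣ ∸ ∣ pick r p s ∩ s ∣
      ≡⟨ cong₂ _∸_ (trans (∣p∩q∣+∣p∩∁q∣≡∣p∣ (pick r p s) s) (∣pick∣ r≤∣p∣)) ∣pick∩s∣ ⟩
    r ∸ r ⊓ ∣ p ∩ s ∣                                     ≡⟨ m∸[m⊓n]≡m∸n r _ ⟩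
    r ∸ ∣ p ∩ s ∣                                         ∎
    where open ≡-Reasoning

-- Walks in the Kneser graph K(2h+1, h)

record KneserWalk (h : ℕ) (A B : Subset n) (m : ℕ) : Set where
  field
    vertex        : ℕ → Subset n
    vertex-start  : vertex 0 ≡ A
    vertex-end    : vertex m ≡ B
    ∣vertex∣      : ∀ j → j ≤ m → ∣ vertex j ∣ ≡ h
    step-disjoint : ∀ j → j < m → Disjoint (vertex j) (vertex (suc j))

KneserWalk-cast : ∀ {h m m′} {A A′ B B′ : Subset n} →
                  A ≡ A′ → B ≡ B′ → m ≡ m′ → KneserWalk h A B m → KneserWalk h A′ B′ m′
KneserWalk-cast refl refl refl w = w

-- Step 2a of the walk has traded the a lowest elements of U for those of V
-- while keeping F; the odd steps in between are built on G instead.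
module Interpolation (F G U V : Subset n)
  (F#G : Disjoint F G) (F#U : Disjoint F U) (F#V : Disjoint F V)
  (G#U : Disjoint G U) (G#V : Disjoint G V) (U#V : Disjoint U V) where

  evenStep oddStep : ℕ → Subset n
  evenStep a = F ∪ ((U ∩ ∁ (lowest a U)) ∪ lowest a V)
  oddStep  a = G ∪ (lowest a U ∪ (V ∩ ∁ (lowest (suc a) V)))

  evenStep#oddStep : ∀ a → Disjoint (evenStep a) (oddStep a)
  evenStep#oddStep a = Disjoint-∪³
    F#G (Disjoint-⊆ ⊆-refl (lowest-⊆ a U) F#U) (Disjoint-⊆ ⊆-refl (p∩q⊆p V _) F#V)
    (Disjoint-⊆ (p∩q⊆p U _) ⊆-refl (Disjoint-sym G#U)) (Disjoint-sym (lowest#rest a a U ≤-refl))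
      (Disjoint-⊆ (p∩q⊆p U _) (p∩q⊆p V _) U#V)
    (Disjoint-⊆ (lowest-⊆ a V) ⊆-refl (Disjoint-sym G#V))
      (Disjoint-⊆ (lowest-⊆ a V) (lowest-⊆ a U) (Disjoint-sym U#V)) (lowest#rest a (suc a) V (n≤1+n a))

  oddStep#evenStep : ∀ a → Disjoint (oddStep a) (evenStep (suc a))
  oddStep#evenStep a = Disjoint-∪³
    (Disjoint-sym F#G) (Disjoint-⊆ ⊆-refl (p∩q⊆p U _) G#U) (Disjoint-⊆ ⊆-refl (lowest-⊆ (suc a) V) G#V)
    (Disjoint-⊆ (lowest-⊆ a U) ⊆-refl (Disjoint-sym F#U)) (lowest#rest a (suc a) U (n≤1+n a))
      (Disjoint-⊆ (lowest-⊆ a U) (lowest-⊆ (suc a) V) U#V)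
    (Disjoint-⊆ (p∩q⊆p V _) ⊆-refl (Disjoint-sym F#V))
      (Disjoint-⊆ (p∩q⊆p V _) (p∩q⊆p U _) (Disjoint-sym U#V)) (Disjoint-sym (lowest#rest (suc a) (suc a) V ≤-refl))

  interpolant : ℕ → ℕ → Subset n
  interpolant a zero          = evenStep a
  interpolant a (suc zero)    = oddStep a
  interpolant a (suc (suc j)) = interpolant (suc a) j

  interpolant-disjoint : ∀ a j → Disjoint (interpolant a j) (interpolant a (suc j))
  interpolant-disjoint a zero          = evenStep#oddStep a
  interpolant-disjoint a (suc zero)    = oddStep#evenStep a
  interpolant-disjoint a (suc (suc j)) = interpolant-disjoint (suc a) j

  interpolant-shift : ∀ m a j → interpolant a (m + m + j) ≡ interpolant (m + a) j
  interpolant-shift zero    a j = refl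
  interpolant-shift (suc m) a j = begin
    interpolant a (suc m + suc m + j)  ≡⟨ cong (λ x → interpolant a (suc (x + j))) (+-suc m m) ⟩
    interpolant (suc a) (m + m + j)    ≡⟨ interpolant-shift m (suc a) j ⟩
    interpolant (m + suc a) j          ≡⟨ cong (λ x → interpolant x j) (+-suc m a) ⟩
    interpolant (suc m + a) j          ∎
    where open ≡-Reasoning

  interpolant-start : interpolant 0 0 ≡ F ∪ U
  interpolant-start = cong (F ∪_) (trans (∪-identityʳ _) (p∩∁⊥≡p U))

  interpolant-end-even : ∣ V ∣ ≡ ∣ U ∣ → interpolant 0 (∣ U ∣ + ∣ V ∣) ≡ F ∪ V
  interpolant-end-even v≡u = begin
    interpolant 0 (∣ U ∣ + ∣ V ∣)     ≡⟨ cong (interpolant 0) (trans (cong (∣ U ∣ +_) v≡u) (sym (+-identityʳ _))) ⟩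
    interpolant 0 (∣ U ∣ + ∣ U ∣ + 0) ≡⟨ interpolant-shift ∣ U ∣ 0 0 ⟩
    evenStep (∣ U ∣ + 0)              ≡⟨ cong evenStep (+-identityʳ ∣ U ∣) ⟩
    F ∪ ((U ∩ ∁ (lowest ∣ U ∣ U)) ∪ lowest ∣ U ∣ V)
      ≡⟨ cong₂ (λ x y → F ∪ ((U ∩ ∁ x) ∪ y)) (lowest-all _ U ≤-refl) (lowest-all _ V (≤-reflexive v≡u)) ⟩
    F ∪ ((U ∩ ∁ U) ∪ V)               ≡⟨ cong (λ x → F ∪ (x ∪ V)) (∩-inverseʳ U) ⟩
    F ∪ (⊥ ∪ V)                       ≡⟨ cong (F ∪_) (∪-identityˡ V) ⟩
    F ∪ V                             ∎
    where open ≡-Reasoning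

  interpolant-end-odd : ∣ V ∣ ≡ suc ∣ U ∣ → interpolant 0 (∣ U ∣ + ∣ V ∣) ≡ G ∪ U
  interpolant-end-odd v≡1+u = begin
    interpolant 0 (∣ U ∣ + ∣ V ∣)     ≡⟨ cong (interpolant 0) (trans (cong (∣ U ∣ +_) v≡1+u) (+-comm ∣ U ∣ _)) ⟩
    interpolant 0 (suc ∣ U ∣ + ∣ U ∣)  ≡⟨ cong (interpolant 0) (+-comm 1 (∣ U ∣ + ∣ U ∣)) ⟩
    interpolant 0 (∣ U ∣ + ∣ U ∣ + 1) ≡⟨ interpolant-shift ∣ U ∣ 0 1 ⟩
    oddStep (∣ U ∣ + 0)               ≡⟨ cong oddStep (+-identityʳ ∣ U ∣) ⟩
    G ∪ (lowest ∣ U ∣ U ∪ (V ∩ ∁ (lowest (suc ∣ U ∣) V)))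
      ≡⟨ cong₂ (λ x y → G ∪ (x ∪ (V ∩ ∁ y))) (lowest-all _ U ≤-refl) (lowest-all _ V (≤-reflexive v≡1+u)) ⟩
    G ∪ (U ∪ (V ∩ ∁ V))               ≡⟨ cong (λ x → G ∪ (U ∪ x)) (∩-inverseʳ V) ⟩
    G ∪ (U ∪ ⊥)                       ≡⟨ cong (G ∪_) (∪-identityʳ U) ⟩
    G ∪ U                             ∎
    where open ≡-Reasoning

  module _ {h} (∣F∣+∣U∣≡h : ∣ F ∣ + ∣ U ∣ ≡ h) (∣G∣+∣V∣≡1+h : ∣ G ∣ + ∣ V ∣ ≡ suc h) where

    ∣evenStep∣ : ∀ a → a ≤ ∣ U ∣ → a ≤ ∣ V ∣ → ∣ evenStep a ∣ ≡ h
    ∣evenStep∣ a a≤u a≤v = begin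
      ∣ F ∪ ((U ∩ ∁ (lowest a U)) ∪ lowest a V) ∣
        ≡⟨ ∣p∪q∣≡∣p∣+∣q∣ (Disjoint-∪ʳ (Disjoint-⊆ ⊆-refl (p∩q⊆p U _) F#U) (Disjoint-⊆ ⊆-refl (lowest-⊆ a V) F#V)) ⟩
      ∣ F ∣ + ∣ (U ∩ ∁ (lowest a U)) ∪ lowest a V ∣
        ≡⟨ cong (∣ F ∣ +_) (∣p∪q∣≡∣p∣+∣q∣ (Disjoint-⊆ (p∩q⊆p U _) (lowest-⊆ a V) U#V)) ⟩
      ∣ F ∣ + (∣ U ∩ ∁ (lowest a U) ∣ + ∣ lowest a V ∣)
        ≡⟨ cong₂ (λ x y → ∣ F ∣ + (x + y)) (∣p∩∁lowest∣ a U a≤u) (∣lowest∣≡ a V a≤v) ⟩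
      ∣ F ∣ + (∣ U ∣ ∸ a + a) ≡⟨ cong (∣ F ∣ +_) (m∸n+n≡m a≤u) ⟩
      ∣ F ∣ + ∣ U ∣           ≡⟨ ∣F∣+∣U∣≡h ⟩
      h                       ∎
      where open ≡-Reasoning

    ∣oddStep∣ : ∀ a → a ≤ ∣ U ∣ → a < ∣ V ∣ → ∣ oddStep a ∣ ≡ h
    ∣oddStep∣ a a≤u a<v = suc-injective (begin
      suc ∣ G ∪ (lowest a U ∪ (V ∩ ∁ (lowest (suc a) V))) ∣
        ≡⟨ cong suc (∣p∪q∣≡∣p∣+∣q∣ (Disjoint-∪ʳ (Disjoint-⊆ ⊆-refl (lowest-⊆ a U) G#U) (Disjoint-⊆ ⊆-refl (p∩q⊆p V _) G#V))) ⟩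
      suc (∣ G ∣ + ∣ lowest a U ∪ (V ∩ ∁ (lowest (suc a) V)) ∣)
        ≡⟨ cong (λ x → suc (∣ G ∣ + x)) (∣p∪q∣≡∣p∣+∣q∣ (Disjoint-⊆ (lowest-⊆ a U) (p∩q⊆p V _) U#V)) ⟩
      suc (∣ G ∣ + (∣ lowest a U ∣ + ∣ V ∩ ∁ (lowest (suc a) V) ∣))
        ≡⟨ cong₂ (λ x y → suc (∣ G ∣ + (x + y))) (∣lowest∣≡ a U a≤u) (∣p∩∁lowest∣ (suc a) V a<v) ⟩
      suc (∣ G ∣ + (a + (∣ V ∣ ∸ suc a))) ≡⟨ +-suc ∣ G ∣ _ ⟨
      ∣ G ∣ + (suc a + (∣ V ∣ ∸ suc a))   ≡⟨ cong (∣ G ∣ +_) (m+[n∸m]≡n a<v) ⟩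
      ∣ G ∣ + ∣ V ∣                       ≡⟨ ∣G∣+∣V∣≡1+h ⟩
      suc h                               ∎)
      where open ≡-Reasoning

    ∣interpolant∣ : ∣ U ∣ ≤ ∣ V ∣ → ∣ V ∣ ≤ suc ∣ U ∣ →
                    ∀ a j → a + a + j ≤ ∣ U ∣ + ∣ V ∣ → ∣ interpolant a j ∣ ≡ h
    ∣interpolant∣ u≤v v≤1+u a zero le =
      ∣evenStep∣ a (m+m≤1+n+n⇒m≤n (≤-trans 2a≤u+v u+v≤1+u+u)) (m+m≤n+n⇒m≤n (≤-trans 2a≤u+v u+v≤v+v))
      where
      2a≤u+v : a + a ≤ ∣ U ∣ + ∣ V ∣
      2a≤u+v = ≤-trans (m≤m+n (a + a) 0) le
      u+v≤1+u+u : ∣ U ∣ + ∣ V ∣ ≤ suc (∣ U ∣ + ∣ U ∣)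
      u+v≤1+u+u = ≤-trans (+-monoʳ-≤ ∣ U ∣ v≤1+u) (≤-reflexive (+-suc ∣ U ∣ ∣ U ∣))
      u+v≤v+v : ∣ U ∣ + ∣ V ∣ ≤ ∣ V ∣ + ∣ V ∣
      u+v≤v+v = +-monoˡ-≤ ∣ V ∣ u≤v
    ∣interpolant∣ u≤v v≤1+u a (suc zero) le =
      ∣oddStep∣ a (m+m≤1+n+n⇒m≤n (≤-trans (≤-trans (m≤m+n (a + a) 1) le) u+v≤1+u+u))
                  (1+m+m≤n+n⇒m<n (≤-trans (≤-reflexive (+-comm 1 (a + a))) (≤-trans le (+-monoˡ-≤ ∣ V ∣ u≤v))))
      where
      u+v≤1+u+u : ∣ U ∣ + ∣ V ∣ ≤ suc (∣ U ∣ + ∣ U ∣)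
      u+v≤1+u+u = ≤-trans (+-monoʳ-≤ ∣ U ∣ v≤1+u) (≤-reflexive (+-suc ∣ U ∣ ∣ U ∣))
    ∣interpolant∣ u≤v v≤1+u a (suc (suc j)) le =
      ∣interpolant∣ u≤v v≤1+u (suc a) j (subst (_≤ ∣ U ∣ + ∣ V ∣) (shift a j) le)
      where
      shift : ∀ a j → a + a + suc (suc j) ≡ suc a + suc a + j
      shift = solve-∀

    interpolation-walk-even : ∣ V ∣ ≡ ∣ U ∣ → KneserWalk h (F ∪ U) (F ∪ V) (∣ U ∣ + ∣ V ∣)
    interpolation-walk-even v≡u = record
      { vertex        = interpolant 0
      ; vertex-start  = interpolant-start
      ; vertex-end    = interpolant-end-even v≡u
      ; ∣vertex∣      = ∣interpolant∣ (≤-reflexive (sym v≡u)) (≤-trans (≤-reflexive v≡u) (n≤1+n _)) 0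
      ; step-disjoint = λ j _ → interpolant-disjoint 0 j
      }

    interpolation-walk-odd : ∣ V ∣ ≡ suc ∣ U ∣ → KneserWalk h (F ∪ U) (G ∪ U) (∣ U ∣ + ∣ V ∣)
    interpolation-walk-odd v≡1+u = record
      { vertex        = interpolant 0
      ; vertex-start  = interpolant-start
      ; vertex-end    = interpolant-end-odd v≡1+u
      ; ∣vertex∣      = ∣interpolant∣ (≤-trans (n≤1+n _) (≤-reflexive (sym v≡1+u))) (≤-reflexive v≡1+u) 0
      ; step-disjoint = λ j _ → interpolant-disjoint 0 j
      }

module VennRegions (A B : Subset n) where

  both onlyA onlyB neither : Subset n
  both    = A ∩ B
  onlyA   = A ∩ ∁ B
  onlyB   = ∁ A ∩ B
  neither = ∁ A ∩ ∁ B

  both#onlyA : Disjoint both onlyA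
  both#onlyA = Disjoint-⊆ (p∩q⊆q A B) (p∩q⊆q A (∁ B)) Disjoint-∁
  both#onlyB : Disjoint both onlyB
  both#onlyB = Disjoint-⊆ (p∩q⊆p A B) (p∩q⊆p (∁ A) B) Disjoint-∁
  both#neither : Disjoint both neither
  both#neither = Disjoint-⊆ (p∩q⊆p A B) (p∩q⊆p (∁ A) (∁ B)) Disjoint-∁
  onlyA#onlyB : Disjoint onlyA onlyB
  onlyA#onlyB = Disjoint-⊆ (p∩q⊆p A (∁ B)) (p∩q⊆p (∁ A) B) Disjoint-∁
  onlyA#neither : Disjoint onlyA neither
  onlyA#neither = Disjoint-⊆ (p∩q⊆p A (∁ B)) (p∩q⊆p (∁ A) (∁ B)) Disjoint-∁
  onlyB#neither : Disjoint onlyB neither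
  onlyB#neither = Disjoint-⊆ (p∩q⊆q (∁ A) B) (p∩q⊆q (∁ A) (∁ B)) Disjoint-∁

  both∪onlyA≡A : both ∪ onlyA ≡ A
  both∪onlyA≡A = p∩q∪p∩∁q≡p A B

  both∪onlyB≡B : both ∪ onlyB ≡ B
  both∪onlyB≡B = trans (cong₂ _∪_ (∩-comm A B) (∩-comm (∁ A) B)) (p∩q∪p∩∁q≡p B A)

  ∣regions∩∣ : ∀ W → ∣ both ∩ W ∣ + ∣ onlyA ∩ W ∣ + ∣ onlyB ∩ W ∣ + ∣ neither ∩ W ∣ ≡ ∣ W ∣
  ∣regions∩∣ W = begin
    ∣ both ∩ W ∣ + ∣ onlyA ∩ W ∣ + ∣ onlyB ∩ W ∣ + ∣ neither ∩ W ∣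
      ≡⟨ +-assoc (∣ both ∩ W ∣ + ∣ onlyA ∩ W ∣) _ _ ⟩
    (∣ both ∩ W ∣ + ∣ onlyA ∩ W ∣) + (∣ onlyB ∩ W ∣ + ∣ neither ∩ W ∣)
      ≡⟨ cong₂ _+_ (∣p∪q∩s∣≡∣p∩s∣+∣q∩s∣ both#onlyA) (∣p∪q∩s∣≡∣p∩s∣+∣q∩s∣ onlyB#neither) ⟨
    ∣ (both ∪ onlyA) ∩ W ∣ + ∣ (onlyB ∪ neither) ∩ W ∣
      ≡⟨ cong₂ (λ x y → ∣ x ∩ W ∣ + ∣ y ∩ W ∣) both∪onlyA≡A (p∩q∪p∩∁q≡p (∁ A) B) ⟩
    ∣ A ∩ W ∣ + ∣ ∁ A ∩ W ∣
      ≡⟨ cong₂ (λ x y → ∣ x ∣ + ∣ y ∣) (∩-comm A W) (∩-comm (∁ A) W) ⟩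
    ∣ W ∩ A ∣ + ∣ W ∩ ∁ A ∣
      ≡⟨ ∣p∩q∣+∣p∩∁q∣≡∣p∣ W A ⟩
    ∣ W ∣ ∎
    where open ≡-Reasoning

  module Sizes {h} (∣A∣≡h : ∣ A ∣ ≡ h) (∣B∣≡h : ∣ B ∣ ≡ h) (∣∁A∣≡1+h : ∣ ∁ A ∣ ≡ suc h) where

    ∣both∣+∣onlyA∣≡h : ∣ both ∣ + ∣ onlyA ∣ ≡ h
    ∣both∣+∣onlyA∣≡h = trans (∣p∩q∣+∣p∩∁q∣≡∣p∣ A B) ∣A∣≡h

    ∣both∣+∣onlyB∣≡h : ∣ both ∣ + ∣ onlyB ∣ ≡ h
    ∣both∣+∣onlyB∣≡h = trans (cong₂ (λ x y → ∣ x ∣ + ∣ y ∣) (∩-comm A B) (∩-comm (∁ A) B))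
                             (trans (∣p∩q∣+∣p∩∁q∣≡∣p∣ B A) ∣B∣≡h)

    ∣onlyB∣+∣neither∣≡1+h : ∣ onlyB ∣ + ∣ neither ∣ ≡ suc h
    ∣onlyB∣+∣neither∣≡1+h = trans (∣p∩q∣+∣p∩∁q∣≡∣p∣ (∁ A) B) ∣∁A∣≡1+h

    ∣onlyA∣≡h∸∣both∣ : ∣ onlyA ∣ ≡ h ∸ ∣ both ∣
    ∣onlyA∣≡h∸∣both∣ = trans (sym (m+n∸m≡n ∣ both ∣ _)) (cong (_∸ ∣ both ∣) ∣both∣+∣onlyA∣≡h)

    ∣onlyB∣≡h∸∣both∣ : ∣ onlyB ∣ ≡ h ∸ ∣ both ∣
    ∣onlyB∣≡h∸∣both∣ = trans (sym (m+n∸m≡n ∣ both ∣ _)) (cong (_∸ ∣ both ∣) ∣both∣+∣onlyB∣≡h)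

    ∣neither∣≡1+∣both∣ : ∣ neither ∣ ≡ suc ∣ both ∣
    ∣neither∣≡1+∣both∣ = +-cancelˡ-≡ ∣ onlyB ∣ _ _ (begin
      ∣ onlyB ∣ + ∣ neither ∣     ≡⟨ ∣onlyB∣+∣neither∣≡1+h ⟩
      suc h                       ≡⟨ cong suc ∣both∣+∣onlyB∣≡h ⟨
      suc (∣ both ∣ + ∣ onlyB ∣)  ≡⟨ cong suc (+-comm ∣ both ∣ _) ⟩
      suc (∣ onlyB ∣ + ∣ both ∣)  ≡⟨ +-suc ∣ onlyB ∣ _ ⟨
      ∣ onlyB ∣ + suc ∣ both ∣    ∎)
      where open ≡-Reasoning

∣p∣≡h⇒∣∁p∣≡1+h : ∀ {h} (p : Subset (suc (2 * h))) → ∣ p ∣ ≡ h → ∣ ∁ p ∣ ≡ suc h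
∣p∣≡h⇒∣∁p∣≡1+h {h} p ∣p∣≡h = +-cancelˡ-≡ h _ _ (begin
  h + ∣ ∁ p ∣      ≡⟨ cong (_+ ∣ ∁ p ∣) ∣p∣≡h ⟨
  ∣ p ∣ + ∣ ∁ p ∣  ≡⟨ ∣p∣+∣∁p∣≡n p ⟩
  suc (2 * h)      ≡⟨ 1+2h≡h+1+h h ⟩
  h + suc h        ∎)
  where
  open ≡-Reasoning
  1+2h≡h+1+h : ∀ h → suc (2 * h) ≡ h + suc h
  1+2h≡h+1+h = solve-∀

-- The even walk keeps A ∩ B and trades A ∖ B for B ∖ A; the odd one trades A ∩ B for
-- ∁ (A ∪ B), alternating between A ∖ B and B ∖ A.
kneserWalk-even : ∀ {h} (A B : Subset (suc (2 * h))) → ∣ A ∣ ≡ h → ∣ B ∣ ≡ h →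
                  KneserWalk h A B ((h ∸ ∣ A ∩ B ∣) + (h ∸ ∣ A ∩ B ∣))
kneserWalk-even {h} A B ∣A∣≡h ∣B∣≡h =
  KneserWalk-cast both∪onlyA≡A both∪onlyB≡B (cong₂ _+_ ∣onlyA∣≡h∸∣both∣ ∣onlyB∣≡h∸∣both∣)
    (interpolation-walk-even ∣both∣+∣onlyA∣≡h (trans (+-comm ∣ neither ∣ _) ∣onlyB∣+∣neither∣≡1+h)
                             (trans ∣onlyB∣≡h∸∣both∣ (sym ∣onlyA∣≡h∸∣both∣)))
  where
  open VennRegions A B
  open Interpolation both neither onlyA onlyB both#neither both#onlyA both#onlyB
                     (Disjoint-sym onlyA#neither) (Disjoint-sym onlyB#neither) onlyA#onlyB
  open Sizes ∣A∣≡h ∣B∣≡h (∣p∣≡h⇒∣∁p∣≡1+h A ∣A∣≡h)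

kneserWalk-odd : ∀ {h} (A B : Subset (suc (2 * h))) → ∣ A ∣ ≡ h → ∣ B ∣ ≡ h →
                 KneserWalk h A B (∣ A ∩ B ∣ + suc ∣ A ∩ B ∣)
kneserWalk-odd {h} A B ∣A∣≡h ∣B∣≡h =
  KneserWalk-cast (trans (∪-comm onlyA both) both∪onlyA≡A) (trans (∪-comm onlyB both) both∪onlyB≡B)
                  (cong (∣ both ∣ +_) ∣neither∣≡1+∣both∣)
    (interpolation-walk-odd (trans (+-comm ∣ onlyA ∣ _) ∣both∣+∣onlyA∣≡h) ∣onlyB∣+∣neither∣≡1+h ∣neither∣≡1+∣both∣)
  where
  open VennRegions A B
  open Interpolation onlyA onlyB both neither onlyA#onlyB (Disjoint-sym both#onlyA) onlyA#neither
                     (Disjoint-sym both#onlyB) onlyB#neither both#neither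
  open Sizes ∣A∣≡h ∣B∣≡h (∣p∣≡h⇒∣∁p∣≡1+h A ∣A∣≡h)

-- Sets with prescribed overlaps

module VennSelection (A Z : Subset n) (c₁ c₂ c₃ c₄ : ℕ) where
  open VennRegions A Z

  selection : Subset n
  selection = (lowest c₁ both ∪ lowest c₂ onlyA) ∪ (lowest c₃ onlyB ∪ lowest c₄ neither)

  private
    piece#piece : ∀ c c′ {R R′ : Subset n} → Disjoint R R′ → Disjoint (lowest c R) (lowest c′ R′)
    piece#piece c c′ {R} {R′} = Disjoint-⊆ (lowest-⊆ c R) (lowest-⊆ c′ R′)

    halves# : Disjoint (lowest c₁ both ∪ lowest c₂ onlyA) (lowest c₃ onlyB ∪ lowest c₄ neither)
    halves# = Disjoint-∪ˡ (Disjoint-∪ʳ (piece#piece c₁ c₃ both#onlyB) (piece#piece c₁ c₄ both#neither))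
                          (Disjoint-∪ʳ (piece#piece c₂ c₃ onlyA#onlyB) (piece#piece c₂ c₄ onlyA#neither))

    ∣selection∩∣ : ∀ W → ∣ selection ∩ W ∣ ≡
      (∣ lowest c₁ both ∩ W ∣ + ∣ lowest c₂ onlyA ∩ W ∣) + (∣ lowest c₃ onlyB ∩ W ∣ + ∣ lowest c₄ neither ∩ W ∣)
    ∣selection∩∣ W = trans (∣p∪q∩s∣≡∣p∩s∣+∣q∩s∣ halves#)
      (cong₂ _+_ (∣p∪q∩s∣≡∣p∩s∣+∣q∩s∣ (piece#piece c₁ c₂ both#onlyA)) (∣p∪q∩s∣≡∣p∩s∣+∣q∩s∣ (piece#piece c₃ c₄ onlyB#neither)))

  module Counting (c₁≤ : c₁ ≤ ∣ both ∣) (c₂≤ : c₂ ≤ ∣ onlyA ∣) (c₃≤ : c₃ ≤ ∣ onlyB ∣) (c₄≤ : c₄ ≤ ∣ neither ∣) where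

    ∣selection∣ : ∣ selection ∣ ≡ (c₁ + c₂) + (c₃ + c₄)
    ∣selection∣ = trans (∣p∪q∣≡∣p∣+∣q∣ halves#)
      (cong₂ _+_ (trans (∣p∪q∣≡∣p∣+∣q∣ (piece#piece c₁ c₂ both#onlyA)) (cong₂ _+_ (∣lowest∣≡ c₁ both c₁≤) (∣lowest∣≡ c₂ onlyA c₂≤)))
                 (trans (∣p∪q∣≡∣p∣+∣q∣ (piece#piece c₃ c₄ onlyB#neither)) (cong₂ _+_ (∣lowest∣≡ c₃ onlyB c₃≤) (∣lowest∣≡ c₄ neither c₄≤))))

    ∣A∩selection∣ : ∣ A ∩ selection ∣ ≡ c₁ + c₂
    ∣A∩selection∣ = begin
      ∣ A ∩ selection ∣ ≡⟨ cong ∣_∣ (∩-comm A selection) ⟩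
      ∣ selection ∩ A ∣ ≡⟨ ∣selection∩∣ A ⟩
      _                 ≡⟨ cong₂ _+_ (cong₂ _+_ (∣lowest∩∣≡ c₁ (p∩q⊆p A Z) c₁≤) (∣lowest∩∣≡ c₂ (p∩q⊆p A (∁ Z)) c₂≤))
                                     (cong₂ _+_ (∣lowest∩∣≡0 c₃ (Disjoint-⊆ (p∩q⊆p (∁ A) Z) ⊆-refl (Disjoint-sym Disjoint-∁)))
                                                (∣lowest∩∣≡0 c₄ (Disjoint-⊆ (p∩q⊆p (∁ A) (∁ Z)) ⊆-refl (Disjoint-sym Disjoint-∁)))) ⟩
      c₁ + c₂ + 0       ≡⟨ +-identityʳ _ ⟩
      c₁ + c₂           ∎
      where open ≡-Reasoning

    ∣selection∩Z∣ : ∣ selection ∩ Z ∣ ≡ c₁ + c₃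
    ∣selection∩Z∣ = trans (∣selection∩∣ Z)
      (cong₂ _+_ (trans (cong₂ _+_ (∣lowest∩∣≡ c₁ (p∩q⊆q A Z) c₁≤)
                                    (∣lowest∩∣≡0 c₂ (Disjoint-⊆ (p∩q⊆q A (∁ Z)) ⊆-refl (Disjoint-sym Disjoint-∁))))
                        (+-identityʳ c₁))
                 (trans (cong₂ _+_ (∣lowest∩∣≡ c₃ (p∩q⊆q (∁ A) Z) c₃≤)
                                    (∣lowest∩∣≡0 c₄ (Disjoint-⊆ (p∩q⊆q (∁ A) (∁ Z)) ⊆-refl (Disjoint-sym Disjoint-∁))))
                        (+-identityʳ c₃)))

record NextCounts (h a q i r e o : ℕ) : Set where
  field
    c₁ c₂ c₃ c₄ : ℕ
    c₁≤a     : c₁ ≤ a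
    c₂≤q     : c₂ ≤ q
    c₃≤q     : c₃ ≤ q
    c₄≤1+a   : c₄ ≤ suc a
    c₁+c₂≡i  : c₁ + c₂ ≡ i
    c₃+c₄≡r  : c₃ + c₄ ≡ r
    h≤c₁+c₃+e : h ≤ c₁ + c₃ + e
    c₁+c₃≤o  : c₁ + c₃ ≤ o

-- The counts of the next colour in the four regions A ∩ Z, A ∖ Z, Z ∖ A, ∁ (A ∪ Z), of
-- sizes a, q, q, a + 1; the overlap c₁ + c₃ with Z ranges over an interval of which
-- the hypotheses guarantee a point in [h ∸ e, o].
next-counts : ∀ {h a q i r e o} → a + q ≡ h → i + r ≡ h →
              h ≤ a + (r + e) → h ≤ a + (i + suc o) → a ≤ i + e → a ≤ r + o → h ≤ e + o →
              NextCounts h a q i r e o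
next-counts {h} {a} {q} {i} {r} {e} {o} a+q≡h i+r≡h H₁ H₂ H₃ H₄ H₅ =
  let y , z , (l₁≤y , y≤u₁) , (l₂≤z , z≤u₂) , y+z≡x =
        interval-sum l₁≤u₁ l₂≤u₂ (⊓-glb (+-mono-≤ l₁≤u₁ l₂≤u₂) l₁+l₂≤o) (m⊓n≤m (u₁ + u₂) o)
  in record
  { c₁ = y ; c₂ = i ∸ y ; c₃ = z ; c₄ = r ∸ z
  ; c₁≤a      = ≤-trans y≤u₁ (m⊓n≤n i a)
  ; c₂≤q      = ∸≤-swap l₁≤y
  ; c₃≤q      = ≤-trans z≤u₂ (m⊓n≤n r q)
  ; c₄≤1+a    = ∸≤-swap l₂≤z
  ; c₁+c₂≡i   = m+[n∸m]≡n (≤-trans y≤u₁ (m⊓n≤m i a))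
  ; c₃+c₄≡r   = m+[n∸m]≡n (≤-trans z≤u₂ (m⊓n≤m r q))
  ; h≤c₁+c₃+e = subst (λ x → h ≤ x + e) (sym y+z≡x)
                  (subst (h ≤_) (sym (+-distribʳ-⊓ e (u₁ + u₂) o)) (⊓-glb h≤u₁+u₂+e (subst (h ≤_) (+-comm e o) H₅)))
  ; c₁+c₃≤o   = subst (_≤ o) (sym y+z≡x) (m⊓n≤n (u₁ + u₂) o)
  }
  where
  u₁ u₂ l₁ l₂ : ℕ
  u₁ = i ⊓ a
  u₂ = r ⊓ q
  l₁ = i ∸ q
  l₂ = r ∸ suc a

  i≤h : i ≤ h
  i≤h = subst (i ≤_) i+r≡h (m≤m+n i r)
  r≤h : r ≤ h
  r≤h = subst (r ≤_) i+r≡h (m≤n+m r i)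

  l₁≤u₁ : l₁ ≤ u₁
  l₁≤u₁ = ⊓-glb (m∸n≤m i q) (m≤n+o⇒m∸n≤o i q (subst (i ≤_) (trans (sym a+q≡h) (+-comm a q)) i≤h))
  l₂≤u₂ : l₂ ≤ u₂
  l₂≤u₂ = ⊓-glb (m∸n≤m r (suc a))
                 (m≤n+o⇒m∸n≤o r (suc a) (≤-trans r≤h (≤-trans (n≤1+n h) (≤-reflexive (cong suc (sym a+q≡h))))))

  l₁+l₂≤o : l₁ + l₂ ≤ o
  l₁+l₂≤o with i ≤? q
  ... | yes i≤q rewrite m≤n⇒m∸n≡0 i≤q = m≤n+o⇒m∸n≤o r (suc a) (+-cancelʳ-≤ i r (suc a + o) (begin
    r + i            ≡⟨ trans (+-comm r i) i+r≡h ⟩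
    h                ≤⟨ H₂ ⟩
    a + (i + suc o)  ≡⟨ regroup a i o ⟩
    suc a + o + i    ∎))
    where
    open ≤-Reasoning
    regroup : ∀ a i o → a + (i + suc o) ≡ suc a + o + i
    regroup = solve-∀
  ... | no  i≰q =
    subst (λ x → i ∸ q + x ≤ o) (sym (m≤n⇒m∸n≡0 (≤-trans r≤a (n≤1+n a))))
    (subst (_≤ o) (sym (+-identityʳ _)) (m≤n+o⇒m∸n≤o i q (+-cancelʳ-≤ a i (q + o) (begin
      i + a        ≤⟨ +-monoʳ-≤ i H₄ ⟩
      i + (r + o)  ≡⟨ sym (+-assoc i r o) ⟩
      i + r + o    ≡⟨ cong (_+ o) (trans i+r≡h (sym a+q≡h)) ⟩
      a + q + o    ≡⟨ regroup a q o ⟩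
      q + o + a    ∎))))
    where
    open ≤-Reasoning
    regroup : ∀ a q o → a + q + o ≡ q + o + a
    regroup = solve-∀
    r≤a : r ≤ a
    r≤a = +-cancelʳ-≤ i r a (begin
      r + i  ≡⟨ trans (+-comm r i) (trans i+r≡h (sym a+q≡h)) ⟩
      a + q  ≤⟨ +-monoʳ-≤ a (<⇒≤ (≰⇒> i≰q)) ⟩
      a + i  ∎)

  h≤u₁+u₂+e : h ≤ u₁ + u₂ + e
  h≤u₁+u₂+e = subst (h ≤_) (trans (cong (u₁ +_) (sym (+-distribʳ-⊓ e r q))) (sym (+-assoc u₁ u₂ e)))
    (≤⊓+⊓ {a = i} {a} {r + e} {q + e}
      (≤-trans (≤-reflexive (sym i+r≡h)) (≤-trans (+-monoʳ-≤ i (m≤m+n r e)) ≤-refl))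
      (≤-trans (≤-reflexive (sym a+q≡h)) (≤-trans (+-monoˡ-≤ q H₃) (≤-reflexive (regroup i e q))))
      H₁
      (≤-trans (≤-reflexive (sym a+q≡h)) (+-monoʳ-≤ a (m≤m+n q e))))
    where
    regroup : ∀ i e q → i + e + q ≡ i + (q + e)
    regroup = solve-∀

-- Taking the elements of Q outside Z and those of Q′ inside Z first is what keeps
-- ∣ hubSet ∩ Z ∣ within the bounds of hub-bounds.
module HubSet (K Q Q′ Z : Subset n) (p : ℕ)
  (K#Q : Disjoint K Q) (K#Q′ : Disjoint K Q′) (Q#Q′ : Disjoint Q Q′)
  (p≤∣Q∣ : p ≤ ∣ Q ∣) (p≤∣Q′∣ : p ≤ ∣ Q′ ∣) where

  fromQ fromQ′ hubSet : Subset n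
  fromQ  = pick p Q (∁ Z)
  fromQ′ = pick p Q′ Z
  hubSet = K ∪ (fromQ ∪ fromQ′)

  private
    fromQ#fromQ′ : Disjoint fromQ fromQ′
    fromQ#fromQ′ = Disjoint-⊆ (pick-⊆ p Q (∁ Z)) (pick-⊆ p Q′ Z) Q#Q′

    K#fromQ∪fromQ′ : Disjoint K (fromQ ∪ fromQ′)
    K#fromQ∪fromQ′ = Disjoint-∪ʳ (Disjoint-⊆ ⊆-refl (pick-⊆ p Q (∁ Z)) K#Q) (Disjoint-⊆ ⊆-refl (pick-⊆ p Q′ Z) K#Q′)

    ∣hubSet∩∣ : ∀ W → ∣ hubSet ∩ W ∣ ≡ ∣ K ∩ W ∣ + (∣ fromQ ∩ W ∣ + ∣ fromQ′ ∩ W ∣)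
    ∣hubSet∩∣ W = trans (∣p∪q∩s∣≡∣p∩s∣+∣q∩s∣ K#fromQ∪fromQ′)
                        (cong (∣ K ∩ W ∣ +_) (∣p∪q∩s∣≡∣p∩s∣+∣q∩s∣ fromQ#fromQ′))

    ∣fromQ∣ : ∣ fromQ ∣ ≡ p
    ∣fromQ∣ = ∣pick∣ p Q (∁ Z) p≤∣Q∣

    ∣fromQ′∣ : ∣ fromQ′ ∣ ≡ p
    ∣fromQ′∣ = ∣pick∣ p Q′ Z p≤∣Q′∣

  ∣hubSet∣ : ∣ hubSet ∣ ≡ ∣ K ∣ + (p + p)
  ∣hubSet∣ = trans (∣p∪q∣≡∣p∣+∣q∣ K#fromQ∪fromQ′)
                   (cong (∣ K ∣ +_) (trans (∣p∪q∣≡∣p∣+∣q∣ fromQ#fromQ′) (cong₂ _+_ ∣fromQ∣ ∣fromQ′∣)))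

  ∣hubSet∩∣-Q : ∀ W → Q ⊆ W → Disjoint Q′ W → ∣ hubSet ∩ W ∣ ≡ ∣ K ∩ W ∣ + p
  ∣hubSet∩∣-Q W Q⊆W Q′#W = trans (∣hubSet∩∣ W) (cong (∣ K ∩ W ∣ +_) (trans
    (cong₂ _+_ (trans (cong ∣_∣ (⊆⇒∩≡ (⊆-trans (pick-⊆ p Q (∁ Z)) Q⊆W))) ∣fromQ∣)
               (Disjoint⇒∣p∩q∣≡0 (Disjoint-⊆ (pick-⊆ p Q′ Z) ⊆-refl Q′#W)))
    (+-identityʳ p)))

  ∣hubSet∩∣-Q′ : ∀ W → Disjoint Q W → Q′ ⊆ W → ∣ hubSet ∩ W ∣ ≡ ∣ K ∩ W ∣ + p
  ∣hubSet∩∣-Q′ W Q#W Q′⊆W = trans (∣hubSet∩∣ W) (cong (∣ K ∩ W ∣ +_)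
    (cong₂ _+_ (Disjoint⇒∣p∩q∣≡0 (Disjoint-⊆ (pick-⊆ p Q (∁ Z)) ⊆-refl Q#W))
               (trans (cong ∣_∣ (⊆⇒∩≡ (⊆-trans (pick-⊆ p Q′ Z) Q′⊆W))) ∣fromQ′∣)))

  ∣hubSet∩Z∣ : ∣ hubSet ∩ Z ∣ ≡ ∣ K ∩ Z ∣ + ((p ∸ ∣ Q ∩ ∁ Z ∣) + p ⊓ ∣ Q′ ∩ Z ∣)
  ∣hubSet∩Z∣ = trans (∣hubSet∩∣ Z) (cong (∣ K ∩ Z ∣ +_)
    (cong₂ _+_ (subst (λ W → ∣ fromQ ∩ W ∣ ≡ p ∸ ∣ Q ∩ ∁ Z ∣) (∁∁p≡p Z) (∣pick∩∁s∣ p Q (∁ Z) p≤∣Q∣))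
               (∣pick∩s∣ p Q′ Z)))

-- Z meets the regions K, Q, Q′, O (of sizes nK, p + p′, p + p′, nO) in zK, zX, zY, zO
-- elements, and x elements of Q lie outside Z; a is then ∣ hubSet ∩ Z ∣ (see HubSet).
hub-bounds : ∀ {h p p′ zK zX x zY zO nK nO} →
             p ≤ p′ → p′ ≤ suc p → zX + x ≡ p + p′ → zK ≤ nK → zO ≤ nO →
             nK + (p + p) ≤ h → nO + (p′ + p′) ≤ suc h → zK + zX + zY + zO ≡ h →
             let a = zK + ((p ∸ x) + p ⊓ zY) in a + p ≤ h × p + p′ ≤ 2 + (a + a)
hub-bounds {h} {p} {p′} {zK} {zX} {x} {zY} {zO} {nK} {nO} p≤p′ p′≤1+p zX+x≡ zK≤nK zO≤nO nK+2p≤h nO+2p′≤1+h Z≡ =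
  upper , lower
  where
  open ≤-Reasoning
  a : ℕ
  a = zK + ((p ∸ x) + p ⊓ zY)

  zX≤ : zX ≤ (p ∸ x) + p′
  zX≤ = +-cancelʳ-≤ x zX _ (begin
    zX + x               ≡⟨ zX+x≡ ⟩
    p + p′               ≤⟨ +-monoˡ-≤ p′ (m≤n+m∸n p x) ⟩
    x + (p ∸ x) + p′     ≡⟨ regroup x (p ∸ x) p′ ⟩
    (p ∸ x) + p′ + x     ∎)
    where
    regroup : ∀ x y p′ → x + y + p′ ≡ y + p′ + x
    regroup = solve-∀

  upper : a + p ≤ h
  upper with p ≤? x
  ... | yes p≤x = begin
    zK + ((p ∸ x) + p ⊓ zY) + p  ≡⟨ cong (λ y → zK + (y + p ⊓ zY) + p) (m≤n⇒m∸n≡0 p≤x) ⟩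
    zK + p ⊓ zY + p              ≤⟨ +-monoˡ-≤ p (+-monoʳ-≤ zK (m⊓n≤m p zY)) ⟩
    zK + p + p                   ≡⟨ +-assoc zK p p ⟩
    zK + (p + p)                 ≤⟨ +-monoˡ-≤ (p + p) zK≤nK ⟩
    nK + (p + p)                 ≤⟨ nK+2p≤h ⟩
    h                            ∎
  ... | no  p≰x = begin
    zK + ((p ∸ x) + p ⊓ zY) + p  ≡⟨ regroup zK (p ∸ x) (p ⊓ zY) p ⟩
    zK + ((p ∸ x) + p) + p ⊓ zY  ≤⟨ +-mono-≤ (+-monoʳ-≤ zK (+-monoʳ-≤ (p ∸ x) p≤p′)) (m⊓n≤n p zY) ⟩
    zK + ((p ∸ x) + p′) + zY     ≡⟨ cong (λ y → zK + y + zY) zX≡ ⟨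
    zK + zX + zY                 ≤⟨ m≤m+n _ zO ⟩
    zK + zX + zY + zO            ≡⟨ Z≡ ⟩
    h                            ∎
    where
    regroup : ∀ k y m p → k + (y + m) + p ≡ k + (y + p) + m
    regroup = solve-∀
    zX≡ : zX ≡ (p ∸ x) + p′
    zX≡ = +-cancelʳ-≡ x zX _ (begin-equality
      zX + x               ≡⟨ zX+x≡ ⟩
      p + p′               ≡⟨ cong (_+ p′) (m∸n+n≡m (<⇒≤ (≰⇒> p≰x))) ⟨
      (p ∸ x) + x + p′     ≡⟨ regroup′ (p ∸ x) x p′ ⟩
      (p ∸ x) + p′ + x     ∎)
      where
      regroup′ : ∀ y x p′ → y + x + p′ ≡ y + p′ + x
      regroup′ = solve-∀

  lower : p + p′ ≤ 2 + (a + a)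
  lower with p ≤? zY
  ... | yes p≤zY = begin
    p + p′        ≤⟨ +-monoʳ-≤ p p′≤1+p ⟩
    p + suc p     ≡⟨ +-suc p p ⟩
    suc (p + p)   ≤⟨ n≤1+n _ ⟩
    2 + (p + p)   ≤⟨ +-monoʳ-≤ 2 (+-mono-≤ p≤a p≤a) ⟩
    2 + (a + a)   ∎
    where
    p≤a : p ≤ a
    p≤a = ≤-trans (≤-reflexive (sym (m≤n⇒m⊓n≡m p≤zY))) (≤-trans (m≤n+m _ (p ∸ x)) (m≤n+m _ zK))
  ... | no  p≰zY = begin
    p + p′          ≤⟨ +-monoˡ-≤ p′ p≤p′ ⟩
    p′ + p′         ≤⟨ +-mono-≤ p′≤1+a p′≤1+a ⟩
    suc a + suc a   ≡⟨ cong suc (+-suc a a) ⟩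
    2 + (a + a)     ∎
    where
    a≡ : a ≡ zK + ((p ∸ x) + zY)
    a≡ = cong (λ y → zK + ((p ∸ x) + y)) (m≥n⇒m⊓n≡n (<⇒≤ (≰⇒> p≰zY)))
    h≤ : h ≤ a + p′ + nO
    h≤ = begin
      h                              ≡⟨ Z≡ ⟨
      zK + zX + zY + zO              ≤⟨ +-mono-≤ (+-monoˡ-≤ zY (+-monoʳ-≤ zK zX≤)) zO≤nO ⟩
      zK + ((p ∸ x) + p′) + zY + nO  ≡⟨ cong (_+ nO) (regroup zK (p ∸ x) p′ zY) ⟩
      zK + ((p ∸ x) + zY) + p′ + nO  ≡⟨ cong (λ y → y + p′ + nO) a≡ ⟨
      a + p′ + nO                    ∎
      where
      regroup : ∀ k y p′ z → k + (y + p′) + z ≡ k + (y + z) + p′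
      regroup = solve-∀
    p′≤1+a : p′ ≤ suc a
    p′≤1+a = +-cancelʳ-≤ p′ p′ (suc a) (+-cancelˡ-≤ nO _ _ (begin
      nO + (p′ + p′)     ≤⟨ nO+2p′≤1+h ⟩
      suc h              ≤⟨ s≤s h≤ ⟩
      suc (a + p′ + nO)  ≡⟨ regroup a p′ nO ⟩
      nO + (suc a + p′)  ∎))
      where
      regroup : ∀ a p′ nO → suc (a + p′ + nO) ≡ nO + (suc a + p′)
      regroup = solve-∀

-- Necklaces and the bull-necklace

walk-++ : ∀ {V : Set} {E : V → V → Set} {u v w m m′} → Walk E u v m → Walk E v w m′ → Walk E u w (m + m′)
walk-++ here        q = q
walk-++ (stepF e p) q = stepF e (walk-++ p q)
walk-++ (stepB e p) q = stepB e (walk-++ p q)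

walk-rest : ∀ {k b} {bs : List (Bead k)} {u w m} → Walk (NE k bs) u w m → Walk (NE k (b ∷ bs)) (rest u) (rest w) m
walk-rest here        = here
walk-rest (stepF e p) = stepF (restE e) (walk-rest p)
walk-rest (stepB e p) = stepB (restE e) (walk-rest p)

module BullNecklace (h : ℕ) where

  k : ℕ
  k = suc (2 * h)

  k≡1+h+h : k ≡ suc (h + h)
  k≡1+h+h = cong (λ x → suc (h + x)) (+-identityʳ h)

  -- A cycle bead with arcs of lengths d and k ∸ d can join colours A and B exactly when
  -- K(k, h) has A–B walks of both lengths; these are 2 i + 1 and 2 (h ∸ i) for
  -- i = ∣ A ∩ B ∣ (see cyc-arcs), so d determines i.
  beadOverlap : Bead k → ℕ
  beadOverlap edge = 0
  beadOverlap (cyc d _) with evenOdd d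
  ... | even m = h ∸ m
  ... | odd  m = m

  cyc-bounds : ∀ d → T ((0 <ᵇ d) ∧ (d <ᵇ k)) → 0 < d × d < k
  cyc-bounds (suc d) p = s≤s z≤n , <ᵇ⇒< (suc d) k p

  ArcLengths : ℕ → ℕ → Set
  ArcLengths d i = (d ≡ i + suc i × k ∸ d ≡ (h ∸ i) + (h ∸ i))
                 ⊎ (d ≡ (h ∸ i) + (h ∸ i) × k ∸ d ≡ i + suc i)

  cyc-arcs : ∀ d (p : T ((0 <ᵇ d) ∧ (d <ᵇ k))) →
             beadOverlap (cyc d p) ≤ h × ArcLengths d (beadOverlap (cyc d p))
  cyc-arcs d p with evenOdd d | cyc-bounds d p
  ... | even m | _ , d<k = m∸n≤m h m , inj₂ (cong (λ x → x + x) (sym (m∸[m∸n]≡n m≤h)) , k∸d≡)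
    where
    m≤h : m ≤ h
    m≤h = m+m≤n+n⇒m≤n (≤-pred (subst (m + m <_) k≡1+h+h d<k))
    k∸d≡ : k ∸ (m + m) ≡ (h ∸ m) + suc (h ∸ m)
    k∸d≡ = x+d≡k⇒k∸d≡x (trans (split (h ∸ m) m) (cong (λ x → suc (2 * x)) (m+[n∸m]≡n m≤h)))
      where
      split : ∀ r m → r + suc r + (m + m) ≡ suc (2 * (m + r))
      split = solve-∀
  ... | odd m | _ , d<k = m≤h , inj₁ (sym (+-suc m m) , k∸d≡)
    where
    m≤h : m ≤ h
    m≤h = m+m≤n+n⇒m≤n (≤-trans (n≤1+n _) (≤-pred (subst (suc (m + m) <_) k≡1+h+h d<k)))
    k∸d≡ : k ∸ suc (m + m) ≡ (h ∸ m) + (h ∸ m)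
    k∸d≡ = x+d≡k⇒k∸d≡x (trans (split (h ∸ m) m) (cong (λ x → suc (2 * x)) (m+[n∸m]≡n m≤h)))
      where
      split : ∀ r m → r + r + suc (m + m) ≡ suc (2 * (m + r))
      split = solve-∀

  beadOverlap≤h : ∀ b → beadOverlap b ≤ h
  beadOverlap≤h edge      = z≤n
  beadOverlap≤h (cyc d p) = proj₁ (cyc-arcs d p)

  private
    T-∧-middle : ∀ a b c → T (a ∧ (b ∧ c)) → T b × T c
    T-∧-middle true true _ t = _ , t

    T-∧³ : ∀ a b c → T a → T b → T c → T (a ∧ (b ∧ c))
    T-∧³ true true true _ _ _ = _

    T-not : ∀ {x} → T (not x) → ¬ T x
    T-not {false} _ ()

  inner⇒< : ∀ {d j} → T (isInner k d j) → j < k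
  inner⇒< {d} {j} q = <ᵇ⇒< j k (proj₁ (T-∧-middle (0 <ᵇ j) (j <ᵇ k) (not (j ≡ᵇ d)) q))

  inner⇒≢ : ∀ {d j} → T (isInner k d j) → j ≢ d
  inner⇒≢ {d} {j} q j≡d = T-not (proj₂ (T-∧-middle (0 <ᵇ j) (j <ᵇ k) (not (j ≡ᵇ d)) q)) (≡⇒≡ᵇ j d j≡d)

  ¬inner⇒end : ∀ {d j} → j ≤ k → ¬ T (isInner k d j) → j ≢ d → j ≡ 0 ⊎ j ≡ k
  ¬inner⇒end {j = zero}  _   _  _   = inj₁ refl
  ¬inner⇒end {d} {suc j} j≤k nq j≢d with suc j <? k
  ... | no  j≮k = inj₂ (≤-antisym j≤k (≮⇒≥ j≮k))
  ... | yes j<k = contradiction (T-∧³ (0 <ᵇ suc j) (suc j <ᵇ k) (not (suc j ≡ᵇ d)) _ (<⇒<ᵇ j<k) not-d) nq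
    where
    not-d : T (not (suc j ≡ᵇ d))
    not-d rewrite ≢⇒≡ᵇ≡false j≢d = _

  cpos-0 : ∀ {d p bs} → cpos k {d} {p} {bs} 0 ≡ start
  cpos-0 {zero} {()}
  cpos-0 {suc d}     = refl

  module _ {d : ℕ} {p : T ((0 <ᵇ d) ∧ (d <ᵇ k))} {bs : List (Bead k)} where

    pos : ℕ → NV k (cyc d p ∷ bs)
    pos = cpos k {d} {p} {bs}

    pos-0 : pos 0 ≡ start
    pos-0 = cpos-0

    pos-d : pos d ≡ rest start
    pos-d with T? (isInner k d d)
    ... | yes q = contradiction refl (inner⇒≢ {d} {d} q)
    ... | no  _ rewrite ≡ᵇ-refl d = refl

    pos-k : pos k ≡ start
    pos-k with T? (isInner k d k)
    ... | yes q = contradiction (inner⇒< {d} {k} q) (<-irrefl refl)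
    ... | no  _ rewrite ≢⇒≡ᵇ≡false {k} {d} (>⇒≢ {k} {d} (proj₂ (cyc-bounds d p))) = refl

    E : NV k (cyc d p ∷ bs) → NV k (cyc d p ∷ bs) → Set
    E = NE k (cyc d p ∷ bs)

    walk-forward : ∀ m j → j + m ≤ k → Walk E (pos j) (pos (j + m)) m
    walk-forward zero    j _ = subst (λ x → Walk E (pos j) (pos x) 0) (sym (+-identityʳ j)) here
    walk-forward (suc m) j le = stepF (cycE {d = d} {p = p} {bs = bs} j (<-≤-trans (s≤s (m≤m+n j m)) le′))
      (subst (λ x → Walk E (pos (suc j)) (pos x) m) (sym (+-suc j m)) (walk-forward m (suc j) le′))
      where
      le′ : suc j + m ≤ k
      le′ = subst (_≤ k) (+-suc j m) le

    walk-backward : ∀ m j → j + m ≤ k → Walk E (pos (j + m)) (pos j) m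
    walk-backward zero    j _ = subst (λ x → Walk E (pos x) (pos j) 0) (sym (+-identityʳ j)) here
    walk-backward (suc m) j le = subst (λ x → Walk E (pos x) (pos j) (suc m)) (sym (+-suc j m))
      (stepB (cycE {d = d} {p = p} {bs = bs} (j + m) le′) (walk-backward m j (<⇒≤ le′)))
      where
      le′ : suc (j + m) ≤ k
      le′ = subst (_≤ k) (+-suc j m) le

    short-arc : Walk E start (rest start) d
    short-arc = subst₂ (λ x y → Walk E x y d) pos-0 pos-d (walk-forward d 0 (<⇒≤ (proj₂ (cyc-bounds d p))))

    long-arc : Walk E start (rest start) (k ∸ d)
    long-arc = subst₂ (λ x y → Walk E x y (k ∸ d)) (trans (cong pos (m+[n∸m]≡n d≤k)) pos-k) pos-d
                 (walk-backward (k ∸ d) d (≤-reflexive (m+[n∸m]≡n d≤k)))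
      where
      d≤k : d ≤ k
      d≤k = <⇒≤ (proj₂ (cyc-bounds d p))

    extend : Subset k → (NV k bs → Subset k) → (ℕ → Subset k) → NV k (cyc d p ∷ bs) → Subset k
    extend A ψ β start        = A
    extend A ψ β (rest x)     = ψ x
    extend A ψ β (innerV j _) = β j

    extend-pos : ∀ {A ψ β} → β 0 ≡ A → β d ≡ ψ start → β k ≡ A →
                 ∀ j → j ≤ k → extend A ψ β (pos j) ≡ β j
    extend-pos β0 βd βk j j≤k with T? (isInner k d j)
    ... | yes _ = refl
    ... | no nq with j ≟ d
    ...   | yes refl rewrite ≡ᵇ-refl j = sym βd
    ...   | no  j≢d with ¬inner⇒end j≤k nq j≢d
    ...     | inj₁ refl rewrite ≢⇒≡ᵇ≡false j≢d = sym β0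
    ...     | inj₂ refl rewrite ≢⇒≡ᵇ≡false j≢d = sym βk

  arcs⇒walks : ∀ {d i} {P : ℕ → Set} → ArcLengths d i →
               P (i + suc i) → P ((h ∸ i) + (h ∸ i)) → P d × P (k ∸ d)
  arcs⇒walks {P = P} (inj₁ (d≡ , k∸d≡)) w-odd w-even = subst P (sym d≡) w-odd , subst P (sym k∸d≡) w-even
  arcs⇒walks {P = P} (inj₂ (d≡ , k∸d≡)) w-odd w-even = subst P (sym d≡) w-even , subst P (sym k∸d≡) w-odd

  walks⇒arcs : ∀ {d i} {P : ℕ → Set} → ArcLengths d i →
               P d → P (k ∸ d) → P (i + suc i) × P ((h ∸ i) + (h ∸ i))
  walks⇒arcs {P = P} (inj₁ (d≡ , k∸d≡)) short long = subst P d≡ short , subst P k∸d≡ long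
  walks⇒arcs {P = P} (inj₂ (d≡ , k∸d≡)) short long = subst P k∸d≡ long , subst P d≡ short

  -- Position j of the cycle c₀ … c_{k-1} c_k = c₀ (with c_d = z_{i+1}) gets vertex j of W₁
  -- on the arc c₀ … c_d, and vertex k ∸ j of W₂ on the arc c_d … c_k.
  module ArcColouring {A B : Subset k} {d} (d<k : d < k)
                      (W₁ : KneserWalk h A B d) (W₂ : KneserWalk h A B (k ∸ d)) where
    private
      module W₁ = KneserWalk W₁
      module W₂ = KneserWalk W₂

    arcColour : ℕ → Subset k
    arcColour j with j ≤? d
    ... | yes _ = W₁.vertex j
    ... | no  _ = W₂.vertex (k ∸ j)

    arcColour-≤ : ∀ {j} → j ≤ d → arcColour j ≡ W₁.vertex j
    arcColour-≤ {j} j≤d with j ≤? d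
    ... | yes _   = refl
    ... | no  j≰d = contradiction j≤d j≰d

    arcColour-≥ : ∀ {j} → d ≤ j → arcColour j ≡ W₂.vertex (k ∸ j)
    arcColour-≥ {j} d≤j with j ≤? d
    ... | no  _   = refl
    ... | yes j≤d with ≤-antisym j≤d d≤j
    ...   | refl = trans W₁.vertex-end (sym W₂.vertex-end)

    arcColour-0 : arcColour 0 ≡ A
    arcColour-0 = trans (arcColour-≤ z≤n) W₁.vertex-start

    arcColour-d : arcColour d ≡ B
    arcColour-d = trans (arcColour-≤ ≤-refl) W₁.vertex-end

    arcColour-k : arcColour k ≡ A
    arcColour-k = trans (arcColour-≥ (<⇒≤ d<k)) (trans (cong W₂.vertex (n∸n≡0 k)) W₂.vertex-start)

    ∣arcColour∣ : ∀ j → j ≤ k → ∣ arcColour j ∣ ≡ h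
    ∣arcColour∣ j j≤k with j ≤? d
    ... | yes j≤d = W₁.∣vertex∣ j j≤d
    ... | no  j≰d = W₂.∣vertex∣ (k ∸ j) (∸-monoʳ-≤ k (<⇒≤ (≰⇒> j≰d)))

    arcColour-step : ∀ j → j < k → Disjoint (arcColour j) (arcColour (suc j))
    arcColour-step j j<k with d ≤? j
    ... | no  d≰j = subst₂ Disjoint (sym (arcColour-≤ (<⇒≤ (≰⇒> d≰j)))) (sym (arcColour-≤ (≰⇒> d≰j)))
                      (W₁.step-disjoint j (≰⇒> d≰j))
    ... | yes d≤j = subst₂ Disjoint
                      (sym (trans (arcColour-≥ d≤j) (cong W₂.vertex (∸-suc j<k))))
                      (sym (arcColour-≥ (≤-trans d≤j (n≤1+n j))))
                      (Disjoint-sym (W₂.step-disjoint (k ∸ suc j) (∸-monoʳ-< (s≤s d≤j) j<k)))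

  record NecklaceColouring (bs : List (Bead k)) (A Z : Subset k) : Set where
    field
      colour       : NV k bs → Subset k
      colour-start : colour start ≡ A
      colour-end   : colour (end k bs) ≡ Z
      proper       : IsFracColoring k h (NE k bs) colour

  colour-bead : ∀ b {bs A B Z} → ∣ A ∣ ≡ h → ∣ B ∣ ≡ h → ∣ A ∩ B ∣ ≡ beadOverlap b →
                NecklaceColouring bs B Z → NecklaceColouring (b ∷ bs) A Z
  colour-bead edge {bs} {A} ∣A∣≡h _ A∩B≡0 ψ = record
    { colour = colour ; colour-start = refl ; colour-end = ψ.colour-end ; proper = size , disjoint }
    where
    module ψ = NecklaceColouring ψ
    colour : NV k (edge ∷ bs) → Subset k
    colour start    = A
    colour (rest x) = ψ.colour x
    size : ∀ u → ∣ colour u ∣ ≡ h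
    size start    = ∣A∣≡h
    size (rest x) = proj₁ ψ.proper x
    disjoint : ∀ {u w} → NE k (edge ∷ bs) u w → Disjoint (colour u) (colour w)
    disjoint plainE    = subst (Disjoint A) (sym ψ.colour-start) (∣p∩q∣≡0⇒Disjoint A∩B≡0)
    disjoint (restE e) = proj₂ ψ.proper e
  colour-bead (cyc d p) {bs} {A} {B} ∣A∣≡h ∣B∣≡h A∩B≡i ψ = record
    { colour = colour ; colour-start = refl ; colour-end = ψ.colour-end ; proper = size , disjoint }
    where
    module ψ = NecklaceColouring ψ
    walks : KneserWalk h A B d × KneserWalk h A B (k ∸ d)
    walks = arcs⇒walks {P = KneserWalk h A B} (proj₂ (cyc-arcs d p))
      (subst (λ c → KneserWalk h A B (c + suc c)) A∩B≡i (kneserWalk-odd A B ∣A∣≡h ∣B∣≡h))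
      (subst (λ c → KneserWalk h A B ((h ∸ c) + (h ∸ c))) A∩B≡i (kneserWalk-even A B ∣A∣≡h ∣B∣≡h))
    open ArcColouring (proj₂ (cyc-bounds d p)) (proj₁ walks) (proj₂ walks)
    colour : NV k (cyc d p ∷ bs) → Subset k
    colour = extend {d} {p} {bs} A ψ.colour arcColour
    colour-pos : ∀ j → j ≤ k → colour (pos j) ≡ arcColour j
    colour-pos = extend-pos arcColour-0 (trans arcColour-d (sym ψ.colour-start)) arcColour-k
    size : ∀ u → ∣ colour u ∣ ≡ h
    size start        = ∣A∣≡h
    size (rest x)     = proj₁ ψ.proper x
    size (innerV j q) = ∣arcColour∣ j (<⇒≤ (inner⇒< {d} {j} q))
    disjoint : ∀ {u w} → NE k (cyc d p ∷ bs) u w → Disjoint (colour u) (colour w)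
    disjoint (cycE j j<k) = subst₂ Disjoint (sym (colour-pos j (<⇒≤ j<k))) (sym (colour-pos (suc j) j<k))
                              (arcColour-step j j<k)
    disjoint (restE e)    = proj₂ ψ.proper e

  -- A z₀–z_m walk of length 2 x (resp. 2 x + 1), or else x ≥ h, in which case the bound
  -- that x imposes on overlaps (which are at most h) is vacuous.
  EvenWalk OddWalk : List (Bead k) → ℕ → Set
  EvenWalk bs x = Walk (NE k bs) start (end k bs) (x + x) ⊎ h ≤ x
  OddWalk  bs x = Walk (NE k bs) start (end k bs) (suc (x + x)) ⊎ h ≤ x

  -- Halves of the lengths of an even and an odd z₀–z_m walk (rounded down), assembled
  -- from the arcs 2 (h ∸ i) and 2 i + 1 of the beads, with h standing for "no walk".
  mutual
    halfEven : List (Bead k) → ℕ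
    halfEven []       = 0
    halfEven (b ∷ bs) = ((h ∸ beadOverlap b) + halfEven bs) ⊓ (beadOverlap b + suc (halfOdd bs))

    halfOdd : List (Bead k) → ℕ
    halfOdd []       = h
    halfOdd (b ∷ bs) = (beadOverlap b + halfEven bs) ⊓ ((h ∸ beadOverlap b) + halfOdd bs)

  h≤halfEven+halfOdd : ∀ bs → h ≤ halfEven bs + halfOdd bs
  h≤halfEven+halfOdd []       = ≤-refl
  h≤halfEven+halfOdd (b ∷ bs) = ≤⊓+⊓ {a = r + e} {i + suc o} {i + e} {r + o}
    (≤-trans h≤r+i (+-mono-≤ (m≤m+n r e) (m≤m+n i e)))
    (≤-trans h≤e+o (+-mono-≤ (m≤n+m e r) (m≤n+m o r)))
    (≤-trans h≤e+o (subst (_≤ (i + suc o) + (i + e)) (+-comm o e) (+-mono-≤ (≤-trans (n≤1+n o) (m≤n+m (suc o) i)) (m≤n+m e i))))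
    (≤-trans h≤r+i (subst (_≤ (i + suc o) + (r + o)) (+-comm i r) (+-mono-≤ (m≤m+n i (suc o)) (m≤m+n r o))))
    where
    i r e o : ℕ
    i = beadOverlap b
    r = h ∸ i
    e = halfEven bs
    o = halfOdd bs
    h≤r+i : h ≤ r + i
    h≤r+i = ≤-reflexive (sym (m∸n+n≡m (beadOverlap≤h b)))
    h≤e+o : h ≤ e + o
    h≤e+o = h≤halfEven+halfOdd bs

  bead-walks : ∀ b bs → let i = beadOverlap b in
    Walk (NE k (b ∷ bs)) start (rest start) (i + suc i) ×
    (Walk (NE k (b ∷ bs)) start (rest start) ((h ∸ i) + (h ∸ i)) ⊎ h ≤ h ∸ i)
  bead-walks edge      bs = stepF plainE here , inj₂ ≤-refl
  bead-walks (cyc d p) bs with walks⇒arcs {P = Walk (NE k (cyc d p ∷ bs)) start (rest start)}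
                                 (proj₂ (cyc-arcs d p)) short-arc long-arc
  ... | odd-arc , even-arc = odd-arc , inj₁ even-arc

  private
    join : ∀ {b bs ℓ₁ ℓ₂ ℓ x y z} →
           Walk (NE k (b ∷ bs)) start (rest start) ℓ₁ ⊎ h ≤ x → Walk (NE k bs) start (end k bs) ℓ₂ ⊎ h ≤ y →
           ℓ₁ + ℓ₂ ≡ ℓ → x ≤ z → y ≤ z → Walk (NE k (b ∷ bs)) start (end k (b ∷ bs)) ℓ ⊎ h ≤ z
    join (inj₁ w₁)  (inj₁ w₂)  ℓ≡ _   _   = inj₁ (subst (Walk _ start _) ℓ≡ (walk-++ w₁ (walk-rest w₂)))
    join (inj₂ h≤x) _          _  x≤z _   = inj₂ (≤-trans h≤x x≤z)
    join (inj₁ _)   (inj₂ h≤y) _  _   y≤z = inj₂ (≤-trans h≤y y≤z)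

  necklace-walks : ∀ bs → EvenWalk bs (halfEven bs) × OddWalk bs (halfOdd bs)
  necklace-walks []       = inj₁ here , inj₂ ≤-refl
  necklace-walks (b ∷ bs) =
    ⊓-pick {EvenWalk (b ∷ bs)} (r + e) (i + suc o)
      (join even-arc (proj₁ tail) (ee r e) (m≤m+n r e) (m≤n+m e r))
      (join (inj₁ odd-arc) (proj₂ tail) (oo i o) ≤-refl (≤-trans (n≤1+n o) (m≤n+m (suc o) i))) ,
    ⊓-pick {OddWalk (b ∷ bs)} (i + e) (r + o)
      (join (inj₁ odd-arc) (proj₁ tail) (oe i e) ≤-refl (m≤n+m e i))
      (join even-arc (proj₂ tail) (eo r o) (m≤m+n r o) (m≤n+m o r))
    where
    i r e o : ℕ
    i = beadOverlap b
    r = h ∸ i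
    e = halfEven bs
    o = halfOdd bs
    odd-arc : Walk (NE k (b ∷ bs)) start (rest start) (i + suc i)
    odd-arc = proj₁ (bead-walks b bs)
    even-arc : Walk (NE k (b ∷ bs)) start (rest start) (r + r) ⊎ h ≤ r
    even-arc = proj₂ (bead-walks b bs)
    tail : EvenWalk bs e × OddWalk bs o
    tail = necklace-walks bs
    ee : ∀ r e → r + r + (e + e) ≡ (r + e) + (r + e)
    ee = solve-∀
    oo : ∀ i o → i + suc i + suc (o + o) ≡ (i + suc o) + (i + suc o)
    oo = solve-∀
    oe : ∀ i e → i + suc i + (e + e) ≡ suc ((i + e) + (i + e))
    oe = solve-∀
    eo : ∀ r o → r + r + suc (o + o) ≡ suc ((r + o) + (r + o))
    eo = solve-∀

  dist-bounds : ∀ {bs s t a} → (∀ n → Walk (NE k bs) start (end k bs) n → s ≤ n) → k ≤ t + s →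
                t ≤ 2 + (a + a) → a + a + t ≤ k → a ≤ h → h ≤ a + halfEven bs × a ≤ halfOdd bs
  dist-bounds {bs} {s} {t} {a} shortest k≤t+s t≤2+2a 2a+t≤k a≤h =
    even-bound (proj₁ (necklace-walks bs)) , odd-bound (proj₂ (necklace-walks bs))
    where
    e o : ℕ
    e = halfEven bs
    o = halfOdd bs
    even-bound : EvenWalk bs e → h ≤ a + e
    even-bound (inj₂ h≤e) = ≤-trans h≤e (m≤n+m e a)
    even-bound (inj₁ w)   = m+m≤1+n+n⇒m≤n (≤-pred (begin
      suc (h + h)              ≡⟨ k≡1+h+h ⟨
      k                        ≤⟨ k≤t+s ⟩
      t + s                    ≤⟨ +-mono-≤ t≤2+2a (shortest _ w) ⟩
      2 + (a + a) + (e + e)    ≡⟨ regroup a e ⟩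
      suc (suc ((a + e) + (a + e))) ∎))
      where
      open ≤-Reasoning
      regroup : ∀ a e → 2 + (a + a) + (e + e) ≡ suc (suc ((a + e) + (a + e)))
      regroup = solve-∀
    odd-bound : OddWalk bs o → a ≤ o
    odd-bound (inj₂ h≤o) = ≤-trans a≤h h≤o
    odd-bound (inj₁ w)   = m+m≤1+n+n⇒m≤n (+-cancelʳ-≤ t _ _ (begin
      a + a + t          ≤⟨ 2a+t≤k ⟩
      k                  ≤⟨ k≤t+s ⟩
      t + s              ≤⟨ +-monoʳ-≤ t (shortest _ w) ⟩
      t + suc (o + o)    ≡⟨ +-comm t _ ⟩
      suc (o + o) + t    ∎))
      where open ≤-Reasoning

  next-colour : ∀ b bs (A Z : Subset k) → ∣ A ∣ ≡ h → ∣ Z ∣ ≡ h →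
                h ≤ ∣ A ∩ Z ∣ + halfEven (b ∷ bs) → ∣ A ∩ Z ∣ ≤ halfOdd (b ∷ bs) →
                Σ (Subset k) λ B → ∣ B ∣ ≡ h × ∣ A ∩ B ∣ ≡ beadOverlap b ×
                                   h ≤ ∣ B ∩ Z ∣ + halfEven bs × ∣ B ∩ Z ∣ ≤ halfOdd bs
  next-colour b bs A Z ∣A∣≡h ∣Z∣≡h h≤a+e′ a≤o′ =
    selection , ∣B∣≡h , trans ∣A∩selection∣ c₁+c₂≡i ,
    subst (λ x → h ≤ x + halfEven bs) (sym ∣selection∩Z∣) h≤c₁+c₃+e ,
    subst (_≤ halfOdd bs) (sym ∣selection∩Z∣) c₁+c₃≤o
    where
    i : ℕ
    i = beadOverlap b
    open VennRegions A Z
    open Sizes ∣A∣≡h ∣Z∣≡h (∣p∣≡h⇒∣∁p∣≡1+h A ∣A∣≡h)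
    counts : NextCounts h ∣ both ∣ ∣ onlyA ∣ i (h ∸ i) (halfEven bs) (halfOdd bs)
    counts = next-counts ∣both∣+∣onlyA∣≡h (m+[n∸m]≡n (beadOverlap≤h b))
      (≤-trans h≤a+e′ (+-monoʳ-≤ ∣ both ∣ (m⊓n≤m _ _))) (≤-trans h≤a+e′ (+-monoʳ-≤ ∣ both ∣ (m⊓n≤n _ _)))
      (≤-trans a≤o′ (m⊓n≤m _ _)) (≤-trans a≤o′ (m⊓n≤n _ _)) (h≤halfEven+halfOdd bs)
    open NextCounts counts
    open VennSelection A Z c₁ c₂ c₃ c₄
    open Counting c₁≤a c₂≤q (subst (c₃ ≤_) (trans ∣onlyA∣≡h∸∣both∣ (sym ∣onlyB∣≡h∸∣both∣)) c₃≤q)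
                  (subst (c₄ ≤_) (sym ∣neither∣≡1+∣both∣) c₄≤1+a)
    ∣B∣≡h : ∣ selection ∣ ≡ h
    ∣B∣≡h = trans ∣selection∣ (trans (cong₂ _+_ c₁+c₂≡i c₃+c₄≡r) (m+[n∸m]≡n (beadOverlap≤h b)))

  necklace-colouring : ∀ bs (A Z : Subset k) → ∣ A ∣ ≡ h → ∣ Z ∣ ≡ h →
                       h ≤ ∣ A ∩ Z ∣ + halfEven bs → ∣ A ∩ Z ∣ ≤ halfOdd bs → NecklaceColouring bs A Z
  necklace-colouring [] A Z ∣A∣≡h ∣Z∣≡h h≤a+0 _ = record
    { colour = λ _ → A ; colour-start = refl ; colour-end = A≡Z ; proper = (λ _ → ∣A∣≡h) , λ () }
    where
    ∣A∩Z∣≡h : ∣ A ∩ Z ∣ ≡ h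
    ∣A∩Z∣≡h = ≤-antisym (subst (∣ A ∩ Z ∣ ≤_) ∣A∣≡h (∣p∩q∣≤∣p∣ A Z)) (subst (h ≤_) (+-identityʳ _) h≤a+0)
    A≡Z : A ≡ Z
    A≡Z = ⊆-antisym (∣p∩q∣≡∣p∣⇒p⊆q (trans ∣A∩Z∣≡h (sym ∣A∣≡h)))
                    (∣p∩q∣≡∣p∣⇒p⊆q (trans (cong ∣_∣ (∩-comm Z A)) (trans ∣A∩Z∣≡h (sym ∣Z∣≡h))))
  necklace-colouring (b ∷ bs) A Z ∣A∣≡h ∣Z∣≡h h≤a+e a≤o =
    let B , ∣B∣≡h , ∣A∩B∣≡i , h≤b+e′ , b≤o′ = next-colour b bs A Z ∣A∣≡h ∣Z∣≡h h≤a+e a≤o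
    in colour-bead b ∣A∣≡h ∣B∣≡h ∣A∩B∣≡i (necklace-colouring bs B Z ∣B∣≡h ∣Z∣≡h h≤b+e′ b≤o′)

  record HubColour (t : ℕ) (X Y Z : Subset k) : Set where
    field
      colour   : Subset k
      ∣colour∣ : ∣ colour ∣ ≡ h
      walk-X   : KneserWalk h colour X t
      walk-Y   : KneserWalk h colour Y t
      t≤2+2c   : t ≤ 2 + (∣ colour ∩ Z ∣ + ∣ colour ∩ Z ∣)
      2c+t≤k   : ∣ colour ∩ Z ∣ + ∣ colour ∩ Z ∣ + t ≤ k

  private
    t-bounds : ∀ {p p′ t a} → t ≡ p + p′ → p′ ≤ suc p → a + p ≤ h → p + p′ ≤ 2 + (a + a) →
               t ≤ 2 + (a + a) × a + a + t ≤ k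
    t-bounds {p} {p′} {t} {a} refl p′≤1+p a+p≤h lower = lower , (begin
      a + a + (p + p′)          ≤⟨ +-monoʳ-≤ (a + a) (+-monoʳ-≤ p p′≤1+p) ⟩
      a + a + (p + suc p)       ≡⟨ regroup a p ⟩
      suc ((a + p) + (a + p))   ≤⟨ s≤s (+-mono-≤ a+p≤h a+p≤h) ⟩
      suc (h + h)               ≡⟨ k≡1+h+h ⟨
      k                         ∎)
      where
      open ≤-Reasoning
      regroup : ∀ a p → a + a + (p + suc p) ≡ suc ((a + p) + (a + p))
      regroup = solve-∀

  module HubColouring {t} (X Y Z : Subset k) (∣X∣≡h : ∣ X ∣ ≡ h) (∣Y∣≡h : ∣ Y ∣ ≡ h) (∣Z∣≡h : ∣ Z ∣ ≡ h)
                      (∣both∣≡h∸t : ∣ X ∩ Y ∣ ≡ h ∸ t) (t≤h : t ≤ h) where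
    open VennRegions X Y
    open Sizes ∣X∣≡h ∣Y∣≡h (∣p∣≡h⇒∣∁p∣≡1+h X ∣X∣≡h)

    ∣onlyA∣≡t : ∣ onlyA ∣ ≡ t
    ∣onlyA∣≡t = trans ∣onlyA∣≡h∸∣both∣ (trans (cong (h ∸_) ∣both∣≡h∸t) (m∸[m∸n]≡n t≤h))
    ∣onlyB∣≡t : ∣ onlyB ∣ ≡ t
    ∣onlyB∣≡t = trans ∣onlyB∣≡h∸∣both∣ (trans (cong (h ∸_) ∣both∣≡h∸t) (m∸[m∸n]≡n t≤h))
    ∣both∣+t≡h : ∣ both ∣ + t ≡ h
    ∣both∣+t≡h = trans (cong (_+ t) ∣both∣≡h∸t) (m∸n+n≡m t≤h)

    onlyA∩Z+onlyA∖Z≡t : ∣ onlyA ∩ Z ∣ + ∣ onlyA ∩ ∁ Z ∣ ≡ t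
    onlyA∩Z+onlyA∖Z≡t = trans (∣p∩q∣+∣p∩∁q∣≡∣p∣ onlyA Z) ∣onlyA∣≡t

    Z≡ : ∣ both ∩ Z ∣ + ∣ onlyA ∩ Z ∣ + ∣ onlyB ∩ Z ∣ + ∣ neither ∩ Z ∣ ≡ h
    Z≡ = trans (∣regions∩∣ Z) ∣Z∣≡h

    onlyB#X : Disjoint onlyB X
    onlyB#X = Disjoint-⊆ (p∩q⊆p (∁ X) Y) ⊆-refl (Disjoint-sym Disjoint-∁)
    onlyA#Y : Disjoint onlyA Y
    onlyA#Y = Disjoint-⊆ (p∩q⊆q X (∁ Y)) ⊆-refl (Disjoint-sym Disjoint-∁)

    ≤∣onlyA∣×∣onlyB∣ : ∀ {p q} → p + q ≡ t → p ≤ ∣ onlyA ∣ × p ≤ ∣ onlyB ∣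
    ≤∣onlyA∣×∣onlyB∣ {p} {q} p+q≡t = subst (p ≤_) (trans p+q≡t (sym ∣onlyA∣≡t)) (m≤m+n p q)
                                  , subst (p ≤_) (trans p+q≡t (sym ∣onlyB∣≡t)) (m≤m+n p q)

    even-hub : ∀ {p} → t ≡ p + p → HubColour t X Y Z
    even-hub {p} refl = record
      { colour = hubSet ; ∣colour∣ = ∣hub∣≡h
      ; walk-X = KneserWalk-cast refl refl (cong (λ x → x + x) h∸c≡p)
                   (subst (λ c → KneserWalk h hubSet X ((h ∸ c) + (h ∸ c))) hub∩X (kneserWalk-even hubSet X ∣hub∣≡h ∣X∣≡h))
      ; walk-Y = KneserWalk-cast refl refl (cong (λ x → x + x) h∸c≡p)
                   (subst (λ c → KneserWalk h hubSet Y ((h ∸ c) + (h ∸ c))) hub∩Y (kneserWalk-even hubSet Y ∣hub∣≡h ∣Y∣≡h))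
      ; t≤2+2c = proj₁ bounds
      ; 2c+t≤k = proj₂ bounds
      }
      where
      open HubSet both onlyA onlyB Z p both#onlyA both#onlyB onlyA#onlyB
                  (proj₁ (≤∣onlyA∣×∣onlyB∣ refl)) (proj₂ (≤∣onlyA∣×∣onlyB∣ refl))
      ∣hub∣≡h : ∣ hubSet ∣ ≡ h
      ∣hub∣≡h = trans ∣hubSet∣ ∣both∣+t≡h
      hub∩X : ∣ hubSet ∩ X ∣ ≡ ∣ both ∣ + p
      hub∩X = trans (∣hubSet∩∣-Q X (p∩q⊆p X (∁ Y)) onlyB#X) (cong (λ w → ∣ w ∣ + p) (⊆⇒∩≡ (p∩q⊆p X Y)))
      hub∩Y : ∣ hubSet ∩ Y ∣ ≡ ∣ both ∣ + p
      hub∩Y = trans (∣hubSet∩∣-Q′ Y onlyA#Y (p∩q⊆q (∁ X) Y)) (cong (λ w → ∣ w ∣ + p) (⊆⇒∩≡ (p∩q⊆q X Y)))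
      h∸c≡p : h ∸ (∣ both ∣ + p) ≡ p
      h∸c≡p = x+d≡k⇒k∸d≡x (trans (regroup p ∣ both ∣) ∣both∣+t≡h)
        where
        regroup : ∀ p b → p + (b + p) ≡ b + (p + p)
        regroup = solve-∀
      bounds : let c = ∣ hubSet ∩ Z ∣ in p + p ≤ 2 + (c + c) × c + c + (p + p) ≤ k
      bounds = subst (λ c → p + p ≤ 2 + (c + c) × c + c + (p + p) ≤ k) (sym ∣hubSet∩Z∣) $
               let upper , lower = hub-bounds ≤-refl (n≤1+n p) onlyA∩Z+onlyA∖Z≡t
                                     (∣p∩q∣≤∣p∣ both Z) (∣p∩q∣≤∣p∣ neither Z) (≤-reflexive ∣both∣+t≡h)
                                     (≤-reflexive (trans (cong (_+ (p + p)) ∣neither∣≡1+∣both∣) (cong suc ∣both∣+t≡h))) Z≡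
               in t-bounds refl (n≤1+n p) upper lower
    odd-hub : ∀ {p} → t ≡ suc (p + p) → HubColour t X Y Z
    odd-hub {p} refl = record
      { colour = hubSet ; ∣colour∣ = ∣hub∣≡h
      ; walk-X = KneserWalk-cast refl refl (+-suc p p)
                   (subst (λ c → KneserWalk h hubSet X (c + suc c)) hub∩X (kneserWalk-odd hubSet X ∣hub∣≡h ∣X∣≡h))
      ; walk-Y = KneserWalk-cast refl refl (+-suc p p)
                   (subst (λ c → KneserWalk h hubSet Y (c + suc c)) hub∩Y (kneserWalk-odd hubSet Y ∣hub∣≡h ∣Y∣≡h))
      ; t≤2+2c = proj₁ bounds
      ; 2c+t≤k = proj₂ bounds
      }
      where
      open HubSet neither onlyA onlyB Z p (Disjoint-sym onlyA#neither) (Disjoint-sym onlyB#neither) onlyA#onlyB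
                  (proj₁ (≤∣onlyA∣×∣onlyB∣ (+-suc p p))) (proj₂ (≤∣onlyA∣×∣onlyB∣ (+-suc p p)))
      ∣neither∣+2p≡h : ∣ neither ∣ + (p + p) ≡ h
      ∣neither∣+2p≡h = trans (cong (_+ (p + p)) ∣neither∣≡1+∣both∣) (trans (sym (+-suc ∣ both ∣ _)) ∣both∣+t≡h)
      ∣hub∣≡h : ∣ hubSet ∣ ≡ h
      ∣hub∣≡h = trans ∣hubSet∣ ∣neither∣+2p≡h
      hub∩X : ∣ hubSet ∩ X ∣ ≡ p
      hub∩X = trans (∣hubSet∩∣-Q X (p∩q⊆p X (∁ Y)) onlyB#X)
                    (cong (_+ p) (Disjoint⇒∣p∩q∣≡0 (Disjoint-⊆ (p∩q⊆p (∁ X) (∁ Y)) ⊆-refl (Disjoint-sym Disjoint-∁))))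
      hub∩Y : ∣ hubSet ∩ Y ∣ ≡ p
      hub∩Y = trans (∣hubSet∩∣-Q′ Y onlyA#Y (p∩q⊆q (∁ X) Y))
                    (cong (_+ p) (Disjoint⇒∣p∩q∣≡0 (Disjoint-⊆ (p∩q⊆q (∁ X) (∁ Y)) ⊆-refl (Disjoint-sym Disjoint-∁))))
      bounds : let c = ∣ hubSet ∩ Z ∣ in suc (p + p) ≤ 2 + (c + c) × c + c + suc (p + p) ≤ k
      bounds = subst (λ c → suc (p + p) ≤ 2 + (c + c) × c + c + suc (p + p) ≤ k) (sym ∣hubSet∩Z∣) $
               let upper , lower = hub-bounds (n≤1+n p) ≤-refl (trans onlyA∩Z+onlyA∖Z≡t (sym (+-suc p p)))
                                     (∣p∩q∣≤∣p∣ neither Z) (∣p∩q∣≤∣p∣ both Z) (≤-reflexive ∣neither∣+2p≡h)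
                                     (≤-reflexive (trans (regroup ∣ both ∣ p) (cong suc ∣both∣+t≡h)))
                                     (trans (permute (∣ both ∩ Z ∣) _ _ _) Z≡)
               in t-bounds (sym (+-suc p p)) ≤-refl upper lower
        where
        regroup : ∀ b p → b + (suc p + suc p) ≡ suc (b + suc (p + p))
        regroup = solve-∀
        permute : ∀ a b c d → d + b + c + a ≡ a + b + c + d
        permute = solve-∀

  hub-colour : ∀ {t} (X Y Z : Subset k) → ∣ X ∣ ≡ h → ∣ Y ∣ ≡ h → ∣ Z ∣ ≡ h → ∣ X ∩ Y ∣ ≡ h ∸ t → t ≤ h →
               HubColour t X Y Z
  hub-colour {t} X Y Z ∣X∣≡h ∣Y∣≡h ∣Z∣≡h ∣X∩Y∣≡h∸t t≤h with evenOdd t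
  ... | even p = even-hub {p} refl
    where open HubColouring X Y Z ∣X∣≡h ∣Y∣≡h ∣Z∣≡h ∣X∩Y∣≡h∸t t≤h
  ... | odd  p = odd-hub {p} refl
    where open HubColouring X Y Z ∣X∣≡h ∣Y∣≡h ∣Z∣≡h ∣X∩Y∣≡h∸t t≤h

  bull-colouring : ∀ {t′ bs} {C X Y Z : Subset k} →
    KneserWalk h C X (suc t′) → KneserWalk h C Y (suc t′) → NecklaceColouring bs C Z →
    Σ (BV k t′ bs → Subset k) λ φ → IsFracColoring k h (BE k t′ bs) φ ×
                                     φ (endX k) ≡ X × φ (endY k) ≡ Y × φ (endZ k bs) ≡ Z
  bull-colouring {t′} {bs} Wx Wy ψ =
    φ , (size , disjoint) , end-at Wx , end-at Wy , ψ.colour-end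
    where
    module ψ = NecklaceColouring ψ
    module Wx = KneserWalk Wx
    module Wy = KneserWalk Wy

    φ : BV k t′ bs → Subset k
    φ (xp i) = Wx.vertex (suc (toℕ i))
    φ (yp i) = Wy.vertex (suc (toℕ i))
    φ (nk u) = ψ.colour u

    size : ∀ u → ∣ φ u ∣ ≡ h
    size (xp i) = Wx.∣vertex∣ (suc (toℕ i)) (s≤s (toℕ≤pred[n] i))
    size (yp i) = Wy.∣vertex∣ (suc (toℕ i)) (s≤s (toℕ≤pred[n] i))
    size (nk u) = proj₁ ψ.proper u

    end-at : ∀ {W} (w : KneserWalk h _ W (suc t′)) → KneserWalk.vertex w (suc (toℕ (fromℕ t′))) ≡ W
    end-at w = trans (cong (λ m → KneserWalk.vertex w (suc m)) (toℕ-fromℕ t′)) (KneserWalk.vertex-end w)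

    leave-hub : ∀ {W} (w : KneserWalk h _ W (suc t′)) → Disjoint (ψ.colour start) (KneserWalk.vertex w 1)
    leave-hub w = subst (λ x → Disjoint x (KneserWalk.vertex w 1)) (trans (KneserWalk.vertex-start w) (sym ψ.colour-start))
                    (KneserWalk.step-disjoint w 0 (s≤s z≤n))

    along : ∀ {W} (w : KneserWalk h _ W (suc t′)) (i : Fin t′) →
            Disjoint (KneserWalk.vertex w (suc (toℕ (inject₁ i)))) (KneserWalk.vertex w (suc (suc (toℕ i))))
    along w i = subst (λ m → Disjoint (KneserWalk.vertex w (suc m)) (KneserWalk.vertex w (suc (suc (toℕ i)))))
                  (sym (toℕ-inject₁ i)) (KneserWalk.step-disjoint w (suc (toℕ i)) (s≤s (toℕ<n i)))

    disjoint : ∀ {u w} → BE k t′ bs u w → Disjoint (φ u) (φ w)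
    disjoint xv      = leave-hub Wx
    disjoint (xx i)  = along Wx i
    disjoint yv      = leave-hub Wy
    disjoint (yy i)  = along Wy i
    disjoint (nkE e) = proj₂ ψ.proper e

lemma4p7 : (k h : ℕ) → k ≡ suc (2 * h) → 5 ≤ k →
    (t s : ℕ) → 1 ≤ t → t ≤ h → k ≤ t + s →
    (bs : List (Bead k)) → Dist (NE k bs) (start {k} {bs}) (end k bs) s →
    (φx φy φz : Subset k) → ∣ φx ∣ ≡ h → ∣ φy ∣ ≡ h → ∣ φz ∣ ≡ h →
    ∣ φx ∩ φy ∣ ≡ h ∸ t →
    Σ (BV k (t ∸ 1) bs → Subset k) (λ φ →
    IsFracColoring k h (BE k (t ∸ 1) bs) φ
    × φ (endX k) ≡ φx × φ (endY k) ≡ φy × φ (endZ k bs) ≡ φz)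
lemma4p7 .(suc (2 * h)) h refl _ (suc t′) s _ t≤h k≤t+s bs (_ , shortest) X Y Z ∣X∣≡h ∣Y∣≡h ∣Z∣≡h ∣X∩Y∣≡h∸t =
  bull-colouring walk-X walk-Y
    (necklace-colouring bs colour Z ∣colour∣ ∣Z∣≡h (proj₁ bounds) (proj₂ bounds))
  where
  open BullNecklace h
  open HubColour (hub-colour X Y Z ∣X∣≡h ∣Y∣≡h ∣Z∣≡h ∣X∩Y∣≡h∸t t≤h)
  bounds : h ≤ ∣ colour ∩ Z ∣ + halfEven bs × ∣ colour ∩ Z ∣ ≤ halfOdd bs
  bounds = dist-bounds shortest k≤t+s t≤2+2c 2c+t≤k (subst (∣ colour ∩ Z ∣ ≤_) ∣colour∣ (∣p∩q∣≤∣p∣ colour Z))
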